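{- Let $N \geq 1$ and $n \ge 0$ be integers with $2n > N$. Then \[ S_{N}(n) = \frac{(2n)!}{(2n-N)!}\, \beta^{2n-N+1} \sum_{\ell=0}^{N-1} \binom{N}{\ell+1} \frac{(-1)^{\ell}}{2^{N-1-\ell}} \frac{(\beta+ 1)_{\ell}}{\ell!}, \] interpreted in the symbolic (umbral) sense described in the context.
   Context: $B_m$ denotes the classical Bernoulli numbers, $\sum_{m\ge0} B_m z^m/m! = z/(e^z-1)$. For integers $N\ge 1$, $n\ge 0$, \[ S_{N}(n) := \sum_{j_1+\cdots+j_N=n} \frac{(2n)!}{(2j_{1})! \cdots (2j_{N})!} B_{2j_{1}} \cdots B_{2j_{N}}, \] the sum over all $N$-tuples of nonnegative integers with $j_1+\cdots+j_N=n$. $(x)_\ell = x(x+1)\cdots(x+\ell-1)$ is the Pochhammer symbol. Symbolic convention: $\beta$ is an indeterminate; the right-hand side is first fully expanded as a polynomial in $\beta$, and only afterwards each monomial $\beta^{j}$ is replaced by $B_j/j$ (all exponents occurring are $\ge 2n-N+1 \ge 2$). -}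

module Defs where

open import Data.Nat as ℕ using (ℕ; zero; suc; _∸_; _!; _^_)
open import Data.Nat.Properties using (_!≢0; m^n≢0)
open import Data.Nat.Combinatorics using (_C_)
open import Data.Integer as ℤ using (+_; -[1+_])
open import Data.Rational as ℚ using (ℚ; 0ℚ; 1ℚ; _+_; _*_; -_; _/_)
open import Data.List as L using (List; []; _∷_; _++_; [_]; zipWith; upTo; applyUpTo; concatMap; foldr)
open import Data.Vec as V using (Vec; _∷_)

ℕ→ℚ : ℕ → ℚ
ℕ→ℚ k = (+ k) / 1

inv! : ℕ → ℚ
inv! k = (+ 1) / (k !) where instance _ = k !≢0

inv2^ : ℕ → ℚ
inv2^ k = (+ 1) / (2 ^ k) where instance _ = m^n≢0 2 k

invSuc : ℕ → ℚ
invSuc k = (+ 1) / suc k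

sign : ℕ → ℚ
sign zero = 1ℚ
sign (suc ℓ) = - sign ℓ

sumℚ : List ℚ → ℚ
sumℚ = foldr _+_ 0ℚ

Σ< : ℕ → (ℕ → ℚ) → ℚ
Σ< m f = sumℚ (applyUpTo f m)

-- Bernoulli numbers, z/(e^z-1) convention (B₁ = -1/2):
--   B₀ = 1,  Σ_{k=0}^{m} C(m+1,k) B_k = 0  for m ≥ 1, i.e.
--   B_{m+1} = -(1/(m+2)) Σ_{k=0}^{m} C(m+2,k) B_k.

-- bernList m = [B₀, …, B_{m-1}]
bernList : ℕ → List ℚ
bernList zero = []
bernList (suc m) = bernList m ++ [ next m (bernList m) ]
  where
  next : ℕ → List ℚ → ℚ
  next zero _ = 1ℚ
  next (suc k) prev =
    - (invSuc (suc k) * sumℚ (zipWith (λ i b → ℕ→ℚ ((suc (suc k)) C i) * b) (upTo (suc k)) prev))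

lastℚ : List ℚ → ℚ
lastℚ [] = 0ℚ
lastℚ (x ∷ []) = x
lastℚ (_ ∷ y ∷ ys) = lastℚ (y ∷ ys)

bernoulli : ℕ → ℚ
bernoulli m = lastℚ (bernList (suc m))

-- S_N(n) = Σ_{j₁+…+j_N = n} (2n)!/((2j₁)!⋯(2j_N)!) B_{2j₁}⋯B_{2j_N}

compositions : (N n : ℕ) → List (Vec ℕ N)
compositions zero zero = V.[] ∷ []
compositions zero (suc n) = []
compositions (suc N) n =
  concatMap (λ j → L.map (j ∷_) (compositions N (n ∸ j))) (upTo (suc n))

weight : ∀ {N} → Vec ℕ N → ℚ
weight V.[] = 1ℚ
weight (j ∷ js) = bernoulli (2 ℕ.* j) * inv! (2 ℕ.* j) * weight js

S : (N n : ℕ) → ℚ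
S N n = sumℚ (L.map (λ js → ℕ→ℚ ((2 ℕ.* n) !) * weight js) (compositions N n))

-- Polynomials in the indeterminate β with rational coefficients,
-- represented as coefficient lists [c₀, c₁, …] (c_k = coefficient of β^k).

Poly : Set
Poly = List ℚ

const : ℚ → Poly
const c = c ∷ []

_⊕_ : Poly → Poly → Poly
[] ⊕ q = q
(a ∷ p) ⊕ [] = a ∷ p
(a ∷ p) ⊕ (b ∷ q) = (a + b) ∷ (p ⊕ q)

_⊙_ : ℚ → Poly → Poly
c ⊙ p = L.map (c *_) p

mulβ : Poly → Poly
mulβ p = 0ℚ ∷ p

_⊛_ : Poly → Poly → Poly
[] ⊛ q = []
(a ∷ p) ⊛ q = (a ⊙ q) ⊕ mulβ (p ⊛ q)

βpow : ℕ → Poly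
βpow zero = const 1ℚ
βpow (suc k) = mulβ (βpow k)

βplus : ℚ → Poly
βplus c = c ∷ 1ℚ ∷ []

poch : ℕ → Poly
poch zero = const 1ℚ
poch (suc ℓ) = poch ℓ ⊛ βplus (ℕ→ℚ (suc ℓ))

sumPoly : List Poly → Poly
sumPoly = foldr _⊕_ []

-- Umbral evaluation: after full expansion, replace each β^j by B_j / j.
-- (For j = 0 the value B_j/j is undefined; we send that monomial to 0.
--  In the statement all occurring exponents are ≥ 2, so this never matters.)

umbralCoeff : ℕ → ℚ
umbralCoeff zero = 0ℚ
umbralCoeff (suc k) = bernoulli (suc k) * invSuc k

umbralFrom : ℕ → Poly → ℚ
umbralFrom k [] = 0ℚ
umbralFrom k (c ∷ p) = c * umbralCoeff k + umbralFrom (suc k) p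

umbral : Poly → ℚ
umbral = umbralFrom 0

rhsPoly : (N n : ℕ) → Poly
rhsPoly N n =
  (ℕ→ℚ ((2 ℕ.* n) !) * inv! (2 ℕ.* n ∸ N)) ⊙
    (βpow (2 ℕ.* n ∸ N ℕ.+ 1) ⊛
      sumPoly (applyUpTo
        (λ ℓ → (ℕ→ℚ (N C (suc ℓ)) * sign ℓ * inv2^ (N ∸ 1 ∸ ℓ) * inv! ℓ) ⊙ poch ℓ)
        N))

module Submission where

-- Let h(z) = z/(e^z − 1) + z/2 = (z/2) coth(z/2) = Σ_j B_{2j} z^{2j}/(2j)!, so that S_N(n)/(2n)! is
-- the coefficient of z^{2n} in h^N. Differentiating the defining relation of the Bernoulli numbers,
-- B(z)(e^z − 1) = z, gives the Riccati equation h² + z h′ = h + z²/4, and hence the recursion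
--   (N − 1) h^N + z (h^{N−1})′ = (N − 1) h^{N−1} + (N − 1)/4 · z² h^{N−2}
-- for N ≥ 2, a three-term recursion for the coefficients. On the umbral side the values V(k, ℓ) of
-- β^k (β+1)_ℓ satisfy V(k, ℓ+1) = (ℓ+1) V(k, ℓ) + V(k+1, ℓ); together with Pascal's rule this shows
-- that the right-hand side obeys the same recursion, and the cases N = 0, 1 are immediate.

open import Defs

module ClosedForm where
  open import Data.Nat as ℕ using (ℕ; zero; suc; _!; _∸_; _^_; _≤_; _<_; z≤n; s≤s; s≤s⁻¹)
  import Data.Nat.Properties as ℕₚ
  open import Data.Nat.Combinatorics
    using (_C_; nCk≡n!/k![n-k]!; k![n∸k]!∣n!; nCk≡nC[n∸k]; nC1≡n; k>n⇒nCk≡0; nCk+nC[k+1]≡[n+1]C[k+1])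
  open import Data.Nat.DivMod using (m/n*n≡m)
  import Data.Nat.Coprimality as Coprime
  open import Data.Nat.Induction using (<-rec)
  open import Data.Nat.Tactic.RingSolver using (solve-∀)
  import Data.Integer as ℤ
  import Data.Integer.Properties as ℤₚ
  open import Data.Rational using (ℚ; 0ℚ; 1ℚ; _+_; _*_; -_; _-_; mkℚ; _/_)
  import Data.Rational.Properties as ℚₚ
  open import Data.Rational.Solver using (module +-*-Solver)
  open import Algebra.Properties.Group ℚₚ.+-0-group using () renaming (∙-cancelˡ to +-cancelˡ)
  open import Data.List using (List; []; _∷_; _++_; [_]; map; applyUpTo; upTo; zipWith; concatMap)
  import Data.List.Properties as Listₚ
  open import Data.Vec using (_∷_)
  open import Data.Sum using (inj₁; inj₂)
  open import Data.Product using (_,_)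
  open import Function using (id)
  open import Relation.Binary.PropositionalEquality hiding ([_])
  open +-*-Solver
  open ≡-Reasoning

  -- Rational arithmetic and finite sums

  ℕ→ℚ≡mkℚ : ∀ k → ℕ→ℚ k ≡ mkℚ (ℤ.+ k) 0 (Coprime.sym (Coprime.1-coprimeTo k))
  ℕ→ℚ≡mkℚ k = ℚₚ.normalize-coprime (Coprime.sym (Coprime.1-coprimeTo k))

  ℕ→ℚ-suc : ∀ k → ℕ→ℚ (suc k) ≡ 1ℚ + ℕ→ℚ k
  ℕ→ℚ-suc k = begin
    ℕ→ℚ (suc k)                         ≡⟨ ℚₚ./-cong (cong (λ x → ℤ.+ 1 ℤ.+ x) (sym (ℤₚ.*-identityʳ (ℤ.+ k)))) refl ⟩
    ((ℤ.+ 1) ℤ.* (ℤ.+ 1) ℤ.+ (ℤ.+ k) ℤ.* (ℤ.+ 1)) / 1 ≡⟨ cong (1ℚ +_) (sym (ℕ→ℚ≡mkℚ k)) ⟩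
    1ℚ + ℕ→ℚ k                          ∎

  ℕ→ℚ-+ : ∀ a b → ℕ→ℚ (a ℕ.+ b) ≡ ℕ→ℚ a + ℕ→ℚ b
  ℕ→ℚ-+ zero b = sym (ℚₚ.+-identityˡ (ℕ→ℚ b))
  ℕ→ℚ-+ (suc a) b = begin
    ℕ→ℚ (suc (a ℕ.+ b))    ≡⟨ ℕ→ℚ-suc (a ℕ.+ b) ⟩
    1ℚ + ℕ→ℚ (a ℕ.+ b)     ≡⟨ cong (1ℚ +_) (ℕ→ℚ-+ a b) ⟩
    1ℚ + (ℕ→ℚ a + ℕ→ℚ b)   ≡⟨ sym (ℚₚ.+-assoc 1ℚ (ℕ→ℚ a) (ℕ→ℚ b)) ⟩
    (1ℚ + ℕ→ℚ a) + ℕ→ℚ b   ≡⟨ cong (_+ ℕ→ℚ b) (sym (ℕ→ℚ-suc a)) ⟩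
    ℕ→ℚ (suc a) + ℕ→ℚ b    ∎

  ℕ→ℚ-* : ∀ a b → ℕ→ℚ (a ℕ.* b) ≡ ℕ→ℚ a * ℕ→ℚ b
  ℕ→ℚ-* zero b = sym (ℚₚ.*-zeroˡ (ℕ→ℚ b))
  ℕ→ℚ-* (suc a) b = begin
    ℕ→ℚ (b ℕ.+ a ℕ.* b)      ≡⟨ ℕ→ℚ-+ b (a ℕ.* b) ⟩
    ℕ→ℚ b + ℕ→ℚ (a ℕ.* b)    ≡⟨ cong (ℕ→ℚ b +_) (ℕ→ℚ-* a b) ⟩
    ℕ→ℚ b + ℕ→ℚ a * ℕ→ℚ b    ≡⟨ solve 2 (λ x y → y :+ x :* y := (con 1ℚ :+ x) :* y) refl (ℕ→ℚ a) (ℕ→ℚ b) ⟩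
    (1ℚ + ℕ→ℚ a) * ℕ→ℚ b     ≡⟨ cong (_* ℕ→ℚ b) (sym (ℕ→ℚ-suc a)) ⟩
    ℕ→ℚ (suc a) * ℕ→ℚ b      ∎

  1/d*d≡1 : ∀ d .{{_ : ℕ.NonZero d}} → ((ℤ.+ 1) / d) * ℕ→ℚ d ≡ 1ℚ
  1/d*d≡1 (suc e) = trans
    (cong₂ _*_ (ℚₚ.normalize-coprime (Coprime.1-coprimeTo (suc e))) (ℕ→ℚ≡mkℚ (suc e)))
    (ℚₚ.*-inverseˡ (mkℚ (ℤ.+ suc e) 0 (Coprime.sym (Coprime.1-coprimeTo (suc e)))))

  inv!-inverse : ∀ k → inv! k * ℕ→ℚ (k !) ≡ 1ℚ
  inv!-inverse k = 1/d*d≡1 (k !) {{k ℕₚ.!≢0}}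

  inv2^-inverse : ∀ k → inv2^ k * ℕ→ℚ (2 ^ k) ≡ 1ℚ
  inv2^-inverse k = 1/d*d≡1 (2 ^ k) {{ℕₚ.m^n≢0 2 k}}

  invSuc-inverse : ∀ k → invSuc k * ℕ→ℚ (suc k) ≡ 1ℚ
  invSuc-inverse k = 1/d*d≡1 (suc k)

  inverse-unique : ∀ {x y} a → x * a ≡ 1ℚ → y * a ≡ 1ℚ → x ≡ y
  inverse-unique {x} {y} a xa≡1 ya≡1 = begin
    x              ≡⟨ sym (ℚₚ.*-identityʳ x) ⟩
    x * 1ℚ         ≡⟨ cong (x *_) (sym ya≡1) ⟩
    x * (y * a)    ≡⟨ solve 3 (λ x y a → x :* (y :* a) := y :* (x :* a)) refl x y a ⟩
    y * (x * a)    ≡⟨ cong (y *_) xa≡1 ⟩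
    y * 1ℚ         ≡⟨ ℚₚ.*-identityʳ y ⟩
    y              ∎

  *-inverse-* : ∀ x y {a b} → x * a ≡ 1ℚ → y * b ≡ 1ℚ → (x * y) * (a * b) ≡ 1ℚ
  *-inverse-* x y {a} {b} xa≡1 yb≡1 = begin
    (x * y) * (a * b)   ≡⟨ solve 4 (λ x y a b → (x :* y) :* (a :* b) := (x :* a) :* (y :* b)) refl x y a b ⟩
    (x * a) * (y * b)   ≡⟨ cong₂ _*_ xa≡1 yb≡1 ⟩
    1ℚ                  ∎

  inv!-suc : ∀ k → inv! (suc k) ≡ inv! k * invSuc k
  inv!-suc k = inverse-unique (ℕ→ℚ (suc k !)) (inv!-inverse (suc k)) (begin
    (inv! k * invSuc k) * ℕ→ℚ (suc k ℕ.* k !)       ≡⟨ cong ((inv! k * invSuc k) *_) (trans (ℕ→ℚ-* (suc k) (k !)) (ℚₚ.*-comm (ℕ→ℚ (suc k)) (ℕ→ℚ (k !)))) ⟩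
    (inv! k * invSuc k) * (ℕ→ℚ (k !) * ℕ→ℚ (suc k)) ≡⟨ *-inverse-* (inv! k) (invSuc k) (inv!-inverse k) (invSuc-inverse k) ⟩
    1ℚ                                              ∎)

  inv!-pred : ∀ l → inv! l ≡ ℕ→ℚ (suc l) * inv! (suc l)
  inv!-pred l = begin
    inv! l                               ≡⟨ sym (ℚₚ.*-identityʳ (inv! l)) ⟩
    inv! l * 1ℚ                          ≡⟨ cong (inv! l *_) (sym (invSuc-inverse l)) ⟩
    inv! l * (invSuc l * ℕ→ℚ (suc l))    ≡⟨ solve 3 (λ a b c → a :* (b :* c) := c :* (a :* b)) refl (inv! l) (invSuc l) (ℕ→ℚ (suc l)) ⟩
    ℕ→ℚ (suc l) * (inv! l * invSuc l)    ≡⟨ cong (ℕ→ℚ (suc l) *_) (sym (inv!-suc l)) ⟩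
    ℕ→ℚ (suc l) * inv! (suc l)           ∎

  ½ : ℚ
  ½ = invSuc 1

  ¼ : ℚ
  ¼ = ½ * ½

  inv2^-suc : ∀ k → inv2^ (suc k) ≡ inv2^ k * ½
  inv2^-suc k = inverse-unique (ℕ→ℚ (2 ^ suc k)) (inv2^-inverse (suc k)) (begin
    (inv2^ k * ½) * ℕ→ℚ (2 ℕ.* 2 ^ k)         ≡⟨ cong ((inv2^ k * ½) *_) (trans (ℕ→ℚ-* 2 (2 ^ k)) (ℚₚ.*-comm (ℕ→ℚ 2) (ℕ→ℚ (2 ^ k)))) ⟩
    (inv2^ k * ½) * (ℕ→ℚ (2 ^ k) * ℕ→ℚ 2)     ≡⟨ *-inverse-* (inv2^ k) ½ (inv2^-inverse k) (invSuc-inverse 1) ⟩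
    1ℚ                                        ∎)

  inv2^-+ : ∀ m n → inv2^ (m ℕ.+ n) * ℕ→ℚ (2 ^ n) ≡ inv2^ m
  inv2^-+ m n = inverse-unique (ℕ→ℚ (2 ^ m)) (begin
    inv2^ (m ℕ.+ n) * ℕ→ℚ (2 ^ n) * ℕ→ℚ (2 ^ m)    ≡⟨ solve 3 (λ x a b → x :* a :* b := x :* (b :* a)) refl (inv2^ (m ℕ.+ n)) (ℕ→ℚ (2 ^ n)) (ℕ→ℚ (2 ^ m)) ⟩
    inv2^ (m ℕ.+ n) * (ℕ→ℚ (2 ^ m) * ℕ→ℚ (2 ^ n))  ≡⟨ cong (inv2^ (m ℕ.+ n) *_) (sym (trans (cong ℕ→ℚ (ℕₚ.^-distribˡ-+-* 2 m n)) (ℕ→ℚ-* (2 ^ m) (2 ^ n)))) ⟩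
    inv2^ (m ℕ.+ n) * ℕ→ℚ (2 ^ (m ℕ.+ n))          ≡⟨ inv2^-inverse (m ℕ.+ n) ⟩
    1ℚ                                             ∎) (inv2^-inverse m)

  Σ<-cong : ∀ n {f g} → (∀ i → i < n → f i ≡ g i) → Σ< n f ≡ Σ< n g
  Σ<-cong zero f≡g = refl
  Σ<-cong (suc n) f≡g = cong₂ _+_ (f≡g 0 (s≤s z≤n)) (Σ<-cong n (λ i i<n → f≡g (suc i) (s≤s i<n)))

  Σ<-+ : ∀ n f g → Σ< n (λ i → f i + g i) ≡ Σ< n f + Σ< n g
  Σ<-+ zero f g = refl
  Σ<-+ (suc n) f g = begin
    (f 0 + g 0) + Σ< n (λ i → f (suc i) + g (suc i))
      ≡⟨ cong ((f 0 + g 0) +_) (Σ<-+ n (λ i → f (suc i)) (λ i → g (suc i))) ⟩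
    (f 0 + g 0) + (Σ< n (λ i → f (suc i)) + Σ< n (λ i → g (suc i)))
      ≡⟨ solve 4 (λ a b c d → (a :+ b) :+ (c :+ d) := (a :+ c) :+ (b :+ d)) refl (f 0) (g 0) (Σ< n (λ i → f (suc i))) (Σ< n (λ i → g (suc i))) ⟩
    (f 0 + Σ< n (λ i → f (suc i))) + (g 0 + Σ< n (λ i → g (suc i))) ∎

  Σ<-*ˡ : ∀ n a f → Σ< n (λ i → a * f i) ≡ a * Σ< n f
  Σ<-*ˡ zero a f = sym (ℚₚ.*-zeroʳ a)
  Σ<-*ˡ (suc n) a f = trans (cong (a * f 0 +_) (Σ<-*ˡ n a (λ i → f (suc i)))) (sym (ℚₚ.*-distribˡ-+ a _ _))

  Σ<-zero : ∀ n f → (∀ i → i < n → f i ≡ 0ℚ) → Σ< n f ≡ 0ℚ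
  Σ<-zero n f f≡0 = trans (Σ<-cong n f≡0) (Σ<-const0 n)
    where
    Σ<-const0 : ∀ n → Σ< n (λ _ → 0ℚ) ≡ 0ℚ
    Σ<-const0 zero = refl
    Σ<-const0 (suc n) = trans (ℚₚ.+-identityˡ _) (Σ<-const0 n)

  Σ<-extend : ∀ n d f → (∀ i → n ≤ i → f i ≡ 0ℚ) → Σ< (n ℕ.+ d) f ≡ Σ< n f
  Σ<-extend zero d f f≡0 = Σ<-zero d f (λ i _ → f≡0 i z≤n)
  Σ<-extend (suc n) d f f≡0 = cong (f 0 +_) (Σ<-extend n d (λ i → f (suc i)) (λ i n≤i → f≡0 (suc i) (s≤s n≤i)))

  sumℚ-++ : ∀ xs ys → sumℚ (xs ++ ys) ≡ sumℚ xs + sumℚ ys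
  sumℚ-++ [] ys = sym (ℚₚ.+-identityˡ (sumℚ ys))
  sumℚ-++ (x ∷ xs) ys = trans (cong (x +_) (sumℚ-++ xs ys)) (sym (ℚₚ.+-assoc x (sumℚ xs) (sumℚ ys)))

  Σ<-suc : ∀ n f → Σ< (suc n) f ≡ Σ< n f + f n
  Σ<-suc n f = begin
    sumℚ (applyUpTo f (suc n))         ≡⟨ cong sumℚ (sym (Listₚ.applyUpTo-∷ʳ f n)) ⟩
    sumℚ (applyUpTo f n ++ [ f n ])    ≡⟨ sumℚ-++ (applyUpTo f n) [ f n ] ⟩
    Σ< n f + (f n + 0ℚ)                ≡⟨ cong (Σ< n f +_) (ℚₚ.+-identityʳ (f n)) ⟩
    Σ< n f + f n                       ∎

  -- Binomial coefficients

  C*k!*[n∸k]!≡n! : ∀ {n k} → k ≤ n → (n C k) ℕ.* (k ! ℕ.* (n ∸ k) !) ≡ n !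
  C*k!*[n∸k]!≡n! {n} {k} k≤n = trans (cong (ℕ._* (k ! ℕ.* (n ∸ k) !)) (nCk≡n!/k![n-k]! k≤n))
    (m/n*n≡m {{_}} (k![n∸k]!∣n! k≤n))
    where instance _ = ℕₚ._!*_!≢0 k (n ∸ k)

  C*inv!≡inv!*inv! : ∀ {n k} → k ≤ n → ℕ→ℚ (n C k) * inv! n ≡ inv! k * inv! (n ∸ k)
  C*inv!≡inv!*inv! {n} {k} k≤n =
    inverse-unique (ℕ→ℚ (k !) * ℕ→ℚ ((n ∸ k) !)) (begin
      ℕ→ℚ (n C k) * inv! n * (ℕ→ℚ (k !) * ℕ→ℚ ((n ∸ k) !))
        ≡⟨ solve 3 (λ c i f → c :* i :* f := i :* (c :* f)) refl (ℕ→ℚ (n C k)) (inv! n) (ℕ→ℚ (k !) * ℕ→ℚ ((n ∸ k) !)) ⟩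
      inv! n * (ℕ→ℚ (n C k) * (ℕ→ℚ (k !) * ℕ→ℚ ((n ∸ k) !)))
        ≡⟨ cong (inv! n *_) (sym (trans (ℕ→ℚ-* (n C k) (k ! ℕ.* (n ∸ k) !)) (cong (ℕ→ℚ (n C k) *_) (ℕ→ℚ-* (k !) ((n ∸ k) !))))) ⟩
      inv! n * ℕ→ℚ ((n C k) ℕ.* (k ! ℕ.* (n ∸ k) !))
        ≡⟨ cong (λ m → inv! n * ℕ→ℚ m) (C*k!*[n∸k]!≡n! k≤n) ⟩
      inv! n * ℕ→ℚ (n !)
        ≡⟨ inv!-inverse n ⟩
      1ℚ ∎)
      (*-inverse-* (inv! k) (inv! (n ∸ k)) (inv!-inverse k) (inv!-inverse (n ∸ k)))

  [1+k]*[1+n]C[1+k]≡[1+n]*nCk : ∀ n k → suc k ℕ.* (suc n C suc k) ≡ suc n ℕ.* (n C k)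
  [1+k]*[1+n]C[1+k]≡[1+n]*nCk n k with ℕₚ.≤-<-connex k n
  ... | inj₂ n<k = begin
    suc k ℕ.* (suc n C suc k)   ≡⟨ cong (suc k ℕ.*_) (k>n⇒nCk≡0 (s≤s n<k)) ⟩
    suc k ℕ.* 0                 ≡⟨ ℕₚ.*-zeroʳ (suc k) ⟩
    0                           ≡⟨ sym (ℕₚ.*-zeroʳ (suc n)) ⟩
    suc n ℕ.* 0                 ≡⟨ cong (suc n ℕ.*_) (sym (k>n⇒nCk≡0 n<k)) ⟩
    suc n ℕ.* (n C k)           ∎
  ... | inj₁ k≤n = ℕₚ.*-cancelʳ-≡ _ _ (k ! ℕ.* (n ∸ k) !) {{ℕₚ._!*_!≢0 k (n ∸ k)}} (begin
    suc k ℕ.* (suc n C suc k) ℕ.* (k ! ℕ.* (n ∸ k) !)   ≡⟨ reassoc (suc k) (suc n C suc k) (k !) ((n ∸ k) !) ⟩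
    (suc n C suc k) ℕ.* (suc k ℕ.* k ! ℕ.* (n ∸ k) !)   ≡⟨ C*k!*[n∸k]!≡n! (s≤s k≤n) ⟩
    suc n ℕ.* n !                                       ≡⟨ cong (suc n ℕ.*_) (sym (C*k!*[n∸k]!≡n! k≤n)) ⟩
    suc n ℕ.* ((n C k) ℕ.* (k ! ℕ.* (n ∸ k) !))         ≡⟨ sym (ℕₚ.*-assoc (suc n) (n C k) _) ⟩
    suc n ℕ.* (n C k) ℕ.* (k ! ℕ.* (n ∸ k) !)           ∎)
    where
    reassoc : ∀ a c x y → a ℕ.* c ℕ.* (x ℕ.* y) ≡ c ℕ.* (a ℕ.* x ℕ.* y)
    reassoc = solve-∀

  n*nCk≡k*nCk+[1+k]*nC[1+k] : ∀ n k → n ℕ.* (n C k) ≡ k ℕ.* (n C k) ℕ.+ suc k ℕ.* (n C suc k)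
  n*nCk≡k*nCk+[1+k]*nC[1+k] zero zero = refl
  n*nCk≡k*nCk+[1+k]*nC[1+k] zero (suc k) = sym (cong₂ ℕ._+_ (ℕₚ.*-zeroʳ (suc k)) (ℕₚ.*-zeroʳ (suc (suc k))))
  n*nCk≡k*nCk+[1+k]*nC[1+k] (suc n) zero = trans (ℕₚ.*-identityʳ (suc n)) (sym (trans (ℕₚ.+-identityʳ (suc n C 1)) (nC1≡n (suc n))))
  n*nCk≡k*nCk+[1+k]*nC[1+k] (suc n) (suc k) = begin
    suc n ℕ.* (suc n C suc k)                                           ≡⟨ cong (suc n ℕ.*_) (sym (nCk+nC[k+1]≡[n+1]C[k+1] n k)) ⟩
    suc n ℕ.* (n C k ℕ.+ n C suc k)                                     ≡⟨ ℕₚ.*-distribˡ-+ (suc n) (n C k) (n C suc k) ⟩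
    suc n ℕ.* (n C k) ℕ.+ suc n ℕ.* (n C suc k)                         ≡⟨ sym (cong₂ ℕ._+_ ([1+k]*[1+n]C[1+k]≡[1+n]*nCk n k) ([1+k]*[1+n]C[1+k]≡[1+n]*nCk n (suc k))) ⟩
    suc k ℕ.* (suc n C suc k) ℕ.+ suc (suc k) ℕ.* (suc n C suc (suc k)) ∎

  [1+M]*[2+M]C[1+k]-expand : ∀ M k →
    suc M ℕ.* (suc (suc M) C suc k) ≡ k ℕ.* (suc M C k) ℕ.+ 2 ℕ.* (suc k ℕ.* (suc M C suc k)) ℕ.+ suc M ℕ.* (M C suc k)
  [1+M]*[2+M]C[1+k]-expand M k = begin
    N ℕ.* (suc N C suc k)
      ≡⟨ cong (N ℕ.*_) (sym (nCk+nC[k+1]≡[n+1]C[k+1] N k)) ⟩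
    N ℕ.* (N C k ℕ.+ N C suc k)
      ≡⟨ ℕₚ.*-distribˡ-+ N (N C k) (N C suc k) ⟩
    N ℕ.* (N C k) ℕ.+ N ℕ.* (N C suc k)
      ≡⟨ cong₂ ℕ._+_ (n*nCk≡k*nCk+[1+k]*nC[1+k] N k) (cong (N ℕ.*_) (sym (nCk+nC[k+1]≡[n+1]C[k+1] M k))) ⟩
    (k ℕ.* (N C k) ℕ.+ suc k ℕ.* (N C suc k)) ℕ.+ N ℕ.* (M C k ℕ.+ M C suc k)
      ≡⟨ cong (k ℕ.* (N C k) ℕ.+ suc k ℕ.* (N C suc k) ℕ.+_) (ℕₚ.*-distribˡ-+ N (M C k) (M C suc k)) ⟩
    (k ℕ.* (N C k) ℕ.+ suc k ℕ.* (N C suc k)) ℕ.+ (N ℕ.* (M C k) ℕ.+ N ℕ.* (M C suc k))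
      ≡⟨ cong (λ x → k ℕ.* (N C k) ℕ.+ suc k ℕ.* (N C suc k) ℕ.+ (x ℕ.+ N ℕ.* (M C suc k))) (sym ([1+k]*[1+n]C[1+k]≡[1+n]*nCk M k)) ⟩
    (k ℕ.* (N C k) ℕ.+ suc k ℕ.* (N C suc k)) ℕ.+ (suc k ℕ.* (N C suc k) ℕ.+ N ℕ.* (M C suc k))
      ≡⟨ collect (k ℕ.* (N C k)) (suc k ℕ.* (N C suc k)) (N ℕ.* (M C suc k)) ⟩
    k ℕ.* (N C k) ℕ.+ 2 ℕ.* (suc k ℕ.* (N C suc k)) ℕ.+ N ℕ.* (M C suc k) ∎
    where
    N = suc M
    collect : ∀ a b c → (a ℕ.+ b) ℕ.+ (b ℕ.+ c) ≡ a ℕ.+ 2 ℕ.* b ℕ.+ c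
    collect = solve-∀

  [1+M]*[2+M]C[1+k]-expandℚ : ∀ M k →
    ℕ→ℚ (suc M) * ℕ→ℚ (suc (suc M) C suc k)
      ≡ ℕ→ℚ k * ℕ→ℚ (suc M C k) + ℕ→ℚ 2 * (ℕ→ℚ (suc k) * ℕ→ℚ (suc M C suc k)) + ℕ→ℚ (suc M) * ℕ→ℚ (M C suc k)
  [1+M]*[2+M]C[1+k]-expandℚ M k = begin
    ℕ→ℚ (suc M) * ℕ→ℚ C₂                              ≡⟨ sym (ℕ→ℚ-* (suc M) C₂) ⟩
    ℕ→ℚ (suc M ℕ.* C₂)                                ≡⟨ cong ℕ→ℚ ([1+M]*[2+M]C[1+k]-expand M k) ⟩
    ℕ→ℚ (a ℕ.+ b ℕ.+ c)                               ≡⟨ trans (ℕ→ℚ-+ (a ℕ.+ b) c) (cong (_+ ℕ→ℚ c) (ℕ→ℚ-+ a b)) ⟩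
    ℕ→ℚ a + ℕ→ℚ b + ℕ→ℚ c                             ≡⟨ cong₂ _+_ (cong₂ _+_ (ℕ→ℚ-* k C₁′) (trans (ℕ→ℚ-* 2 (suc k ℕ.* C₁)) (cong (ℕ→ℚ 2 *_) (ℕ→ℚ-* (suc k) C₁)))) (ℕ→ℚ-* (suc M) C₀) ⟩
    ℕ→ℚ k * ℕ→ℚ C₁′ + ℕ→ℚ 2 * (ℕ→ℚ (suc k) * ℕ→ℚ C₁) + ℕ→ℚ (suc M) * ℕ→ℚ C₀ ∎
    where
    C₂ = suc (suc M) C suc k
    C₁′ = suc M C k
    C₁ = suc M C suc k
    C₀ = M C suc k
    a = k ℕ.* C₁′
    b = 2 ℕ.* (suc k ℕ.* C₁)
    c = suc M ℕ.* C₀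

  -- Formal power series

  Series : Set
  Series = ℕ → ℚ

  infix 4 _≈_
  _≈_ : Series → Series → Set
  f ≈ g = ∀ m → f m ≡ g m

  shift : Series → Series
  shift f m = f (suc m)

  infixl 6 _⊞_
  _⊞_ : Series → Series → Series
  (f ⊞ g) m = f m + g m

  infixr 7 _·_
  _·_ : ℚ → Series → Series
  (c · f) m = c * f m

  infixl 7 _∗_
  _∗_ : Series → Series → Series
  (f ∗ g) zero = f 0 * g 0
  (f ∗ g) (suc m) = f 0 * g (suc m) + (shift f ∗ g) m

  θ : Series → Series
  θ f m = ℕ→ℚ m * f m

  z·_ : Series → Series
  (z· f) zero = 0ℚ
  (z· f) (suc m) = f m

  𝟙 : Series
  𝟙 zero = 1ℚ
  𝟙 (suc _) = 0ℚ

  𝕫 : Series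
  𝕫 = z· 𝟙

  ∗-congˡ : ∀ {f f′} g → f ≈ f′ → f ∗ g ≈ f′ ∗ g
  ∗-congˡ g f≈f′ zero = cong (_* g 0) (f≈f′ 0)
  ∗-congˡ g f≈f′ (suc m) = cong₂ _+_ (cong (_* g (suc m)) (f≈f′ 0)) (∗-congˡ g (λ k → f≈f′ (suc k)) m)

  ∗-congʳ : ∀ f {g g′} → g ≈ g′ → f ∗ g ≈ f ∗ g′
  ∗-congʳ f g≈g′ zero = cong (f 0 *_) (g≈g′ 0)
  ∗-congʳ f g≈g′ (suc m) = cong₂ _+_ (cong (f 0 *_) (g≈g′ (suc m))) (∗-congʳ (shift f) g≈g′ m)

  ∗≡Σ : ∀ f g m → (f ∗ g) m ≡ Σ< (suc m) (λ i → f i * g (m ∸ i))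
  ∗≡Σ f g zero = sym (ℚₚ.+-identityʳ (f 0 * g 0))
  ∗≡Σ f g (suc m) = cong (f 0 * g (suc m) +_) (∗≡Σ (shift f) g m)

  ∗-unfoldʳ : ∀ f g m → (f ∗ g) (suc m) ≡ (f ∗ shift g) m + f (suc m) * g 0
  ∗-unfoldʳ f g zero = refl
  ∗-unfoldʳ f g (suc m) = begin
    f 0 * g (suc (suc m)) + (shift f ∗ g) (suc m)
      ≡⟨ cong (f 0 * g (suc (suc m)) +_) (∗-unfoldʳ (shift f) g m) ⟩
    f 0 * g (suc (suc m)) + ((shift f ∗ shift g) m + f (suc (suc m)) * g 0)
      ≡⟨ sym (ℚₚ.+-assoc (f 0 * g (suc (suc m))) ((shift f ∗ shift g) m) (f (suc (suc m)) * g 0)) ⟩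
    f 0 * g (suc (suc m)) + (shift f ∗ shift g) m + f (suc (suc m)) * g 0 ∎

  ∗-comm : ∀ f g → f ∗ g ≈ g ∗ f
  ∗-comm f g zero = ℚₚ.*-comm (f 0) (g 0)
  ∗-comm f g (suc m) = begin
    f 0 * g (suc m) + (shift f ∗ g) m   ≡⟨ cong (f 0 * g (suc m) +_) (∗-comm (shift f) g m) ⟩
    f 0 * g (suc m) + (g ∗ shift f) m   ≡⟨ ℚₚ.+-comm (f 0 * g (suc m)) ((g ∗ shift f) m) ⟩
    (g ∗ shift f) m + f 0 * g (suc m)   ≡⟨ cong ((g ∗ shift f) m +_) (ℚₚ.*-comm (f 0) (g (suc m))) ⟩
    (g ∗ shift f) m + g (suc m) * f 0   ≡⟨ sym (∗-unfoldʳ g f m) ⟩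
    (g ∗ f) (suc m)                     ∎

  ∗-distribʳ-⊞ : ∀ h f g → (f ⊞ g) ∗ h ≈ f ∗ h ⊞ g ∗ h
  ∗-distribʳ-⊞ h f g zero = ℚₚ.*-distribʳ-+ (h 0) (f 0) (g 0)
  ∗-distribʳ-⊞ h f g (suc m) = begin
    (f 0 + g 0) * h (suc m) + ((shift f ⊞ shift g) ∗ h) m
      ≡⟨ cong₂ _+_ (ℚₚ.*-distribʳ-+ (h (suc m)) (f 0) (g 0)) (∗-distribʳ-⊞ h (shift f) (shift g) m) ⟩
    (f 0 * h (suc m) + g 0 * h (suc m)) + ((shift f ∗ h) m + (shift g ∗ h) m)
      ≡⟨ solve 4 (λ a b c d → (a :+ b) :+ (c :+ d) := (a :+ c) :+ (b :+ d)) refl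
           (f 0 * h (suc m)) (g 0 * h (suc m)) ((shift f ∗ h) m) ((shift g ∗ h) m) ⟩
    (f 0 * h (suc m) + (shift f ∗ h) m) + (g 0 * h (suc m) + (shift g ∗ h) m) ∎

  ∗-distribˡ-⊞ : ∀ h f g → h ∗ (f ⊞ g) ≈ h ∗ f ⊞ h ∗ g
  ∗-distribˡ-⊞ h f g m = begin
    (h ∗ (f ⊞ g)) m           ≡⟨ ∗-comm h (f ⊞ g) m ⟩
    ((f ⊞ g) ∗ h) m           ≡⟨ ∗-distribʳ-⊞ h f g m ⟩
    (f ∗ h) m + (g ∗ h) m     ≡⟨ cong₂ _+_ (∗-comm f h m) (∗-comm g h m) ⟩
    (h ∗ f) m + (h ∗ g) m     ∎

  ∗-·ˡ : ∀ c f g → (c · f) ∗ g ≈ c · (f ∗ g)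
  ∗-·ˡ c f g zero = ℚₚ.*-assoc c (f 0) (g 0)
  ∗-·ˡ c f g (suc m) = begin
    c * f 0 * g (suc m) + ((c · shift f) ∗ g) m     ≡⟨ cong₂ _+_ (ℚₚ.*-assoc c (f 0) (g (suc m))) (∗-·ˡ c (shift f) g m) ⟩
    c * (f 0 * g (suc m)) + c * (shift f ∗ g) m     ≡⟨ sym (ℚₚ.*-distribˡ-+ c (f 0 * g (suc m)) ((shift f ∗ g) m)) ⟩
    c * (f 0 * g (suc m) + (shift f ∗ g) m)         ∎

  ∗-·ʳ : ∀ c f g → f ∗ (c · g) ≈ c · (f ∗ g)
  ∗-·ʳ c f g m = begin
    (f ∗ (c · g)) m   ≡⟨ ∗-comm f (c · g) m ⟩
    ((c · g) ∗ f) m   ≡⟨ ∗-·ˡ c g f m ⟩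
    c * (g ∗ f) m     ≡⟨ cong (c *_) (∗-comm g f m) ⟩
    c * (f ∗ g) m     ∎

  ∗-assoc : ∀ f g h → (f ∗ g) ∗ h ≈ f ∗ (g ∗ h)
  ∗-assoc f g h zero = ℚₚ.*-assoc (f 0) (g 0) (h 0)
  ∗-assoc f g h (suc m) = begin
    (f 0 * g 0) * h (suc m) + ((f 0 · shift g ⊞ shift f ∗ g) ∗ h) m
      ≡⟨ cong ((f 0 * g 0) * h (suc m) +_) (∗-distribʳ-⊞ h (f 0 · shift g) (shift f ∗ g) m) ⟩
    (f 0 * g 0) * h (suc m) + (((f 0 · shift g) ∗ h) m + ((shift f ∗ g) ∗ h) m)
      ≡⟨ cong₂ (λ x y → (f 0 * g 0) * h (suc m) + (x + y)) (∗-·ˡ (f 0) (shift g) h m) (∗-assoc (shift f) g h m) ⟩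
    (f 0 * g 0) * h (suc m) + (f 0 * (shift g ∗ h) m + (shift f ∗ (g ∗ h)) m)
      ≡⟨ solve 5 (λ a b c d e → (a :* b) :* c :+ (a :* d :+ e) := a :* (b :* c :+ d) :+ e) refl
           (f 0) (g 0) (h (suc m)) ((shift g ∗ h) m) ((shift f ∗ (g ∗ h)) m) ⟩
    f 0 * (g 0 * h (suc m) + (shift g ∗ h) m) + (shift f ∗ (g ∗ h)) m ∎

  ∗-swapˡ : ∀ f g h → f ∗ (g ∗ h) ≈ g ∗ (f ∗ h)
  ∗-swapˡ f g h m = begin
    (f ∗ (g ∗ h)) m   ≡⟨ sym (∗-assoc f g h m) ⟩
    ((f ∗ g) ∗ h) m   ≡⟨ ∗-congˡ h (∗-comm f g) m ⟩
    ((g ∗ f) ∗ h) m   ≡⟨ ∗-assoc g f h m ⟩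
    (g ∗ (f ∗ h)) m   ∎

  ∗-identityˡ : ∀ f → 𝟙 ∗ f ≈ f
  ∗-identityˡ f zero = ℚₚ.*-identityˡ (f 0)
  ∗-identityˡ f (suc m) = begin
    1ℚ * f (suc m) + (shift 𝟙 ∗ f) m   ≡⟨ cong₂ _+_ (ℚₚ.*-identityˡ (f (suc m))) (∗-zero m) ⟩
    f (suc m) + 0ℚ                     ≡⟨ ℚₚ.+-identityʳ (f (suc m)) ⟩
    f (suc m)                          ∎
    where
    ∗-zero : ∀ m → (shift 𝟙 ∗ f) m ≡ 0ℚ
    ∗-zero zero = ℚₚ.*-zeroˡ (f 0)
    ∗-zero (suc m) = trans (cong₂ _+_ (ℚₚ.*-zeroˡ (f (suc m))) (∗-zero m)) (ℚₚ.+-identityˡ 0ℚ)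

  ∗-identityʳ : ∀ f → f ∗ 𝟙 ≈ f
  ∗-identityʳ f m = trans (∗-comm f 𝟙 m) (∗-identityˡ f m)

  ∗-z·ˡ : ∀ f g → (z· f) ∗ g ≈ z· (f ∗ g)
  ∗-z·ˡ f g zero = ℚₚ.*-zeroˡ (g 0)
  ∗-z·ˡ f g (suc m) = trans (cong (_+ (f ∗ g) m) (ℚₚ.*-zeroˡ (g (suc m)))) (ℚₚ.+-identityˡ ((f ∗ g) m))

  ∗-z·ʳ : ∀ f g → f ∗ (z· g) ≈ z· (f ∗ g)
  ∗-z·ʳ f g zero = trans (∗-comm f (z· g) 0) (∗-z·ˡ g f 0)
  ∗-z·ʳ f g (suc m) = trans (∗-comm f (z· g) (suc m)) (trans (∗-z·ˡ g f (suc m)) (∗-comm g f m))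

  ∗-𝕫ʳ : ∀ f → f ∗ 𝕫 ≈ z· f
  ∗-𝕫ʳ f zero = ∗-z·ʳ f 𝟙 zero
  ∗-𝕫ʳ f (suc m) = trans (∗-z·ʳ f 𝟙 (suc m)) (∗-identityʳ f m)

  ∗-𝕫ˡ : ∀ f → 𝕫 ∗ f ≈ z· f
  ∗-𝕫ˡ f m = trans (∗-comm 𝕫 f m) (∗-𝕫ʳ f m)

  shift-θ : ∀ f → shift (θ f) ≈ θ (shift f) ⊞ shift f
  shift-θ f k = begin
    ℕ→ℚ (suc k) * f (suc k)             ≡⟨ cong (_* f (suc k)) (ℕ→ℚ-suc k) ⟩
    (1ℚ + ℕ→ℚ k) * f (suc k)            ≡⟨ solve 2 (λ a b → (con 1ℚ :+ a) :* b := a :* b :+ b) refl (ℕ→ℚ k) (f (suc k)) ⟩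
    ℕ→ℚ k * f (suc k) + f (suc k)       ∎

  θ-∗ : ∀ f g → θ (f ∗ g) ≈ θ f ∗ g ⊞ f ∗ θ g
  θ-∗ f g zero = solve 2 (λ a b → con 0ℚ :* (a :* b) := con 0ℚ :* a :* b :+ a :* (con 0ℚ :* b)) refl (f 0) (g 0)
  θ-∗ f g (suc m) = begin
    ℕ→ℚ (suc m) * (A * G + X)
      ≡⟨ cong (_* (A * G + X)) (ℕ→ℚ-suc m) ⟩
    (1ℚ + M) * (A * G + X)
      ≡⟨ solve 4 (λ M A G X → (con 1ℚ :+ M) :* (A :* G :+ X) := con 0ℚ :* A :* G :+ (M :* X :+ X) :+ A :* ((con 1ℚ :+ M) :* G)) refl M A G X ⟩
    0ℚ * A * G + (M * X + X) + A * ((1ℚ + M) * G)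
      ≡⟨ cong₂ (λ u v → 0ℚ * A * G + (u + X) + A * (v * G)) (θ-∗ (shift f) g m) (sym (ℕ→ℚ-suc m)) ⟩
    0ℚ * A * G + ((Y + Z) + X) + A * (ℕ→ℚ (suc m) * G)
      ≡⟨ solve 6 (λ A G X Y Z S → con 0ℚ :* A :* G :+ ((Y :+ Z) :+ X) :+ A :* (S :* G) := con 0ℚ :* A :* G :+ (Y :+ X) :+ (A :* (S :* G) :+ Z)) refl A G X Y Z (ℕ→ℚ (suc m)) ⟩
    0ℚ * A * G + (Y + X) + (A * (ℕ→ℚ (suc m) * G) + Z)
      ≡⟨ cong (λ u → 0ℚ * A * G + u + (A * (ℕ→ℚ (suc m) * G) + Z))
           (trans (sym (∗-distribʳ-⊞ g (θ (shift f)) (shift f) m)) (∗-congˡ g (λ k → sym (shift-θ f k)) m)) ⟩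
    0ℚ * A * G + (shift (θ f) ∗ g) m + (A * (ℕ→ℚ (suc m) * G) + Z) ∎
    where
    M = ℕ→ℚ m
    A = f 0
    G = g (suc m)
    X = (shift f ∗ g) m
    Y = (θ (shift f) ∗ g) m
    Z = (shift f ∗ θ g) m

  -- The Bernoulli series

  lastℚ-∷ʳ : ∀ xs x → lastℚ (xs ++ [ x ]) ≡ x
  lastℚ-∷ʳ [] x = refl
  lastℚ-∷ʳ (y ∷ []) x = refl
  lastℚ-∷ʳ (y ∷ z ∷ zs) x = lastℚ-∷ʳ (z ∷ zs) x

  bernList≡applyUpTo : ∀ m → bernList m ≡ applyUpTo bernoulli m
  bernList≡applyUpTo zero = refl
  bernList≡applyUpTo (suc m) = trans
    (cong₂ (λ xs x → xs ++ [ x ]) (bernList≡applyUpTo m) (sym (lastℚ-∷ʳ (bernList m) _)))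
    (Listₚ.applyUpTo-∷ʳ bernoulli m)

  zipWith-applyUpTo : ∀ (f : ℕ → ℚ → ℚ) g h n →
    zipWith f (applyUpTo g n) (applyUpTo h n) ≡ applyUpTo (λ i → f (g i) (h i)) n
  zipWith-applyUpTo f g h zero = refl
  zipWith-applyUpTo f g h (suc n) = cong (f (g 0) (h 0) ∷_) (zipWith-applyUpTo f (λ i → g (suc i)) (λ i → h (suc i)) n)

  bernoulli-suc : ∀ k → bernoulli (suc k) ≡ - (invSuc (suc k) * Σ< (suc k) (λ i → ℕ→ℚ (suc (suc k) C i) * bernoulli i))
  bernoulli-suc k = begin
    bernoulli (suc k)
      ≡⟨ lastℚ-∷ʳ (bernList (suc k)) _ ⟩
    - (invSuc (suc k) * sumℚ (zipWith term (upTo (suc k)) (bernList (suc k))))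
      ≡⟨ cong (λ bs → - (invSuc (suc k) * sumℚ (zipWith term (upTo (suc k)) bs))) (bernList≡applyUpTo (suc k)) ⟩
    - (invSuc (suc k) * sumℚ (zipWith term (upTo (suc k)) (applyUpTo bernoulli (suc k))))
      ≡⟨ cong (λ bs → - (invSuc (suc k) * sumℚ bs)) (zipWith-applyUpTo term id bernoulli (suc k)) ⟩
    - (invSuc (suc k) * Σ< (suc k) (λ i → ℕ→ℚ (suc (suc k) C i) * bernoulli i)) ∎
    where
    term : ℕ → ℚ → ℚ
    term i b = ℕ→ℚ (suc (suc k) C i) * b

  [n+1]Cn≡n+1 : ∀ n → suc n C n ≡ suc n
  [n+1]Cn≡n+1 n = trans (nCk≡nC[n∸k] (ℕₚ.n≤1+n n)) (trans (cong (suc n C_) (ℕₚ.m+n∸n≡m 1 n)) (nC1≡n (suc n)))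

  𝔹 : Series
  𝔹 k = bernoulli k * inv! k

  𝔼 : Series
  𝔼 k = inv! k

  -- z / (e^z − 1) · e^z = z / (e^z − 1) + z, which is the recursion defining the Bernoulli numbers.
  𝔹∗𝔼≈𝔹⊞𝕫 : 𝔹 ∗ 𝔼 ≈ 𝔹 ⊞ 𝕫
  𝔹∗𝔼≈𝔹⊞𝕫 zero = refl
  𝔹∗𝔼≈𝔹⊞𝕫 (suc zero) = refl
  𝔹∗𝔼≈𝔹⊞𝕫 (suc (suc k)) = begin
    (𝔹 ∗ 𝔼) n
      ≡⟨ trans (∗≡Σ 𝔹 𝔼 n) (Σ<-suc n (λ i → 𝔹 i * 𝔼 (n ∸ i))) ⟩
    Σ< n (λ i → 𝔹 i * 𝔼 (n ∸ i)) + 𝔹 n * 𝔼 (n ∸ n)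
      ≡⟨ cong₂ (λ x y → x + 𝔹 n * 𝔼 y) (trans (Σ<-cong n binomial-form) (Σ<-*ˡ n (inv! n) CB)) (ℕₚ.n∸n≡0 n) ⟩
    inv! n * Σ< n CB + 𝔹 n * 1ℚ
      ≡⟨ cong (λ x → inv! n * x + 𝔹 n * 1ℚ) (Σ<-suc (suc k) CB) ⟩
    inv! n * (Sg + ℕ→ℚ (n C suc k) * bernoulli (suc k)) + 𝔹 n * 1ℚ
      ≡⟨ cong₂ (λ x y → inv! n * (Sg + ℕ→ℚ x * y) + 𝔹 n * 1ℚ) ([n+1]Cn≡n+1 (suc k)) (bernoulli-suc k) ⟩
    inv! n * (Sg + ℕ→ℚ n * - (invSuc (suc k) * Sg)) + 𝔹 n * 1ℚ
      ≡⟨ solve 5 (λ i s n v b → i :* (s :+ n :* (:- (v :* s))) :+ b :* con 1ℚ := i :* s :* (con 1ℚ :- v :* n) :+ b) refl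
           (inv! n) Sg (ℕ→ℚ n) (invSuc (suc k)) (𝔹 n) ⟩
    inv! n * Sg * (1ℚ - invSuc (suc k) * ℕ→ℚ n) + 𝔹 n
      ≡⟨ cong (λ x → inv! n * Sg * (1ℚ - x) + 𝔹 n) (invSuc-inverse (suc k)) ⟩
    inv! n * Sg * (1ℚ - 1ℚ) + 𝔹 n
      ≡⟨ solve 2 (λ a b → a :* (con 1ℚ :- con 1ℚ) :+ b := b :+ con 0ℚ) refl (inv! n * Sg) (𝔹 n) ⟩
    𝔹 n + 0ℚ ∎
    where
    n = suc (suc k)
    CB : ℕ → ℚ
    CB i = ℕ→ℚ (n C i) * bernoulli i
    Sg = Σ< (suc k) CB
    binomial-form : ∀ i → i < n → 𝔹 i * 𝔼 (n ∸ i) ≡ inv! n * CB i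
    binomial-form i i<n = begin
      bernoulli i * inv! i * inv! (n ∸ i)       ≡⟨ solve 3 (λ b x y → b :* x :* y := (x :* y) :* b) refl (bernoulli i) (inv! i) (inv! (n ∸ i)) ⟩
      (inv! i * inv! (n ∸ i)) * bernoulli i     ≡⟨ cong (_* bernoulli i) (sym (C*inv!≡inv!*inv! (ℕₚ.<⇒≤ i<n))) ⟩
      (ℕ→ℚ (n C i) * inv! n) * bernoulli i      ≡⟨ solve 3 (λ c i b → (c :* i) :* b := i :* (c :* b)) refl (ℕ→ℚ (n C i)) (inv! n) (bernoulli i) ⟩
      inv! n * CB i                             ∎

  𝔼₊ : Series
  𝔼₊ zero = 0ℚ
  𝔼₊ (suc m) = inv! (suc m)

  𝔹∗𝔼₊≈𝕫 : 𝔹 ∗ 𝔼₊ ≈ 𝕫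
  𝔹∗𝔼₊≈𝕫 m = +-cancelˡ (𝔹 m) ((𝔹 ∗ 𝔼₊) m) (𝕫 m) (begin
    𝔹 m + (𝔹 ∗ 𝔼₊) m              ≡⟨ ℚₚ.+-comm (𝔹 m) ((𝔹 ∗ 𝔼₊) m) ⟩
    (𝔹 ∗ 𝔼₊) m + 𝔹 m              ≡⟨ cong ((𝔹 ∗ 𝔼₊) m +_) (sym (∗-identityʳ 𝔹 m)) ⟩
    (𝔹 ∗ 𝔼₊) m + (𝔹 ∗ 𝟙) m        ≡⟨ sym (∗-distribˡ-⊞ 𝔹 𝔼₊ 𝟙 m) ⟩
    (𝔹 ∗ (𝔼₊ ⊞ 𝟙)) m              ≡⟨ ∗-congʳ 𝔹 𝔼₊⊞𝟙≈𝔼 m ⟩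
    (𝔹 ∗ 𝔼) m                     ≡⟨ 𝔹∗𝔼≈𝔹⊞𝕫 m ⟩
    𝔹 m + 𝕫 m                     ∎)
    where
    𝔼₊⊞𝟙≈𝔼 : 𝔼₊ ⊞ 𝟙 ≈ 𝔼
    𝔼₊⊞𝟙≈𝔼 zero = refl
    𝔼₊⊞𝟙≈𝔼 (suc m) = ℚₚ.+-identityʳ (inv! (suc m))

  θ𝔼₊≈z·𝔼 : θ 𝔼₊ ≈ z· 𝔼
  θ𝔼₊≈z·𝔼 zero = refl
  θ𝔼₊≈z·𝔼 (suc m) = begin
    ℕ→ℚ (suc m) * inv! (suc m)             ≡⟨ cong (ℕ→ℚ (suc m) *_) (inv!-suc m) ⟩
    ℕ→ℚ (suc m) * (inv! m * invSuc m)      ≡⟨ solve 3 (λ a b c → a :* (b :* c) := b :* (c :* a)) refl (ℕ→ℚ (suc m)) (inv! m) (invSuc m) ⟩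
    inv! m * (invSuc m * ℕ→ℚ (suc m))      ≡⟨ cong (inv! m *_) (invSuc-inverse m) ⟩
    inv! m * 1ℚ                            ≡⟨ ℚₚ.*-identityʳ (inv! m) ⟩
    inv! m                                 ∎

  θ𝕫≈𝕫 : θ 𝕫 ≈ 𝕫
  θ𝕫≈𝕫 zero = refl
  θ𝕫≈𝕫 (suc zero) = refl
  θ𝕫≈𝕫 (suc (suc m)) = ℚₚ.*-zeroʳ (ℕ→ℚ (suc (suc m)))

  -- Differentiating 𝔹 · (e^z − 1) = z and multiplying by 𝔹 gives z · (θ𝔹 + 𝔹² + z𝔹) = z · 𝔹.
  𝔹-riccati : ∀ m → θ 𝔹 m + ((𝔹 ∗ 𝔹) m + (z· 𝔹) m) ≡ 𝔹 m
  𝔹-riccati m = begin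
    θ 𝔹 m + ((𝔹 ∗ 𝔹) m + (z· 𝔹) m)
      ≡⟨ cong₂ (λ x y → x + ((𝔹 ∗ 𝔹) m + y)) (sym (∗-𝕫ʳ (θ 𝔹) (suc m))) (sym (∗-𝕫ʳ 𝔹 m)) ⟩
    (θ 𝔹 ∗ 𝕫) (suc m) + ((𝔹 ∗ 𝔹) m + (𝔹 ∗ 𝕫) m)
      ≡⟨ cong ((θ 𝔹 ∗ 𝕫) (suc m) +_) (sym (∗-distribˡ-⊞ 𝔹 𝔹 𝕫 m)) ⟩
    (θ 𝔹 ∗ 𝕫) (suc m) + (𝔹 ∗ (𝔹 ⊞ 𝕫)) m
      ≡⟨ cong₂ _+_ (sym (∗-congʳ (θ 𝔹) 𝔹∗𝔼₊≈𝕫 (suc m))) (sym (∗-congʳ 𝔹 𝔹∗𝔼≈𝔹⊞𝕫 m)) ⟩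
    (θ 𝔹 ∗ (𝔹 ∗ 𝔼₊)) (suc m) + (𝔹 ∗ (𝔹 ∗ 𝔼)) m
      ≡⟨ cong₂ _+_ (∗-swapˡ (θ 𝔹) 𝔹 𝔼₊ (suc m)) (sym (𝔹∗𝔹∗θ𝔼₊ (suc m))) ⟩
    (𝔹 ∗ (θ 𝔹 ∗ 𝔼₊)) (suc m) + (𝔹 ∗ (𝔹 ∗ θ 𝔼₊)) (suc m)
      ≡⟨ sym (∗-distribˡ-⊞ 𝔹 (θ 𝔹 ∗ 𝔼₊) (𝔹 ∗ θ 𝔼₊) (suc m)) ⟩
    (𝔹 ∗ (θ 𝔹 ∗ 𝔼₊ ⊞ 𝔹 ∗ θ 𝔼₊)) (suc m)
      ≡⟨ ∗-congʳ 𝔹 θ𝔹𝔼₊≈𝕫 (suc m) ⟩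
    (𝔹 ∗ 𝕫) (suc m)
      ≡⟨ ∗-𝕫ʳ 𝔹 (suc m) ⟩
    𝔹 m ∎
    where
    𝔹∗𝔹∗θ𝔼₊ : 𝔹 ∗ (𝔹 ∗ θ 𝔼₊) ≈ z· (𝔹 ∗ (𝔹 ∗ 𝔼))
    𝔹∗𝔹∗θ𝔼₊ k = begin
      (𝔹 ∗ (𝔹 ∗ θ 𝔼₊)) k      ≡⟨ ∗-congʳ 𝔹 (∗-congʳ 𝔹 θ𝔼₊≈z·𝔼) k ⟩
      (𝔹 ∗ (𝔹 ∗ z· 𝔼)) k      ≡⟨ ∗-congʳ 𝔹 (∗-z·ʳ 𝔹 𝔼) k ⟩
      (𝔹 ∗ z· (𝔹 ∗ 𝔼)) k      ≡⟨ ∗-z·ʳ 𝔹 (𝔹 ∗ 𝔼) k ⟩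
      (z· (𝔹 ∗ (𝔹 ∗ 𝔼))) k    ∎
    θ𝔹𝔼₊≈𝕫 : θ 𝔹 ∗ 𝔼₊ ⊞ 𝔹 ∗ θ 𝔼₊ ≈ 𝕫
    θ𝔹𝔼₊≈𝕫 k = begin
      (θ 𝔹 ∗ 𝔼₊) k + (𝔹 ∗ θ 𝔼₊) k   ≡⟨ sym (θ-∗ 𝔹 𝔼₊ k) ⟩
      ℕ→ℚ k * (𝔹 ∗ 𝔼₊) k            ≡⟨ cong (ℕ→ℚ k *_) (𝔹∗𝔼₊≈𝕫 k) ⟩
      θ 𝕫 k                         ≡⟨ θ𝕫≈𝕫 k ⟩
      𝕫 k                           ∎

  -- (z/2) coth(z/2) = z / (e^z − 1) + z/2.
  𝔥 : Series
  𝔥 = 𝔹 ⊞ ½ · 𝕫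

  𝔥-riccati : ∀ m → (𝔥 ∗ 𝔥) m + θ 𝔥 m ≡ 𝔥 m + ¼ * (z· 𝕫) m
  𝔥-riccati m = begin
    (𝔥 ∗ 𝔥) m + θ 𝔥 m
      ≡⟨ cong (_+ θ 𝔥 m) (∗-distribʳ-⊞ 𝔥 𝔹 (½ · 𝕫) m) ⟩
    (𝔹 ∗ 𝔥) m + ((½ · 𝕫) ∗ 𝔥) m + θ 𝔥 m
      ≡⟨ cong₂ (λ x y → x + y + θ 𝔥 m) (∗-distribˡ-⊞ 𝔹 𝔹 (½ · 𝕫) m) (∗-·ˡ ½ 𝕫 𝔥 m) ⟩
    (𝔹 ∗ 𝔹) m + (𝔹 ∗ (½ · 𝕫)) m + ½ * (𝕫 ∗ 𝔥) m + θ 𝔥 m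
      ≡⟨ cong₂ (λ x y → (𝔹 ∗ 𝔹) m + x + ½ * y + θ 𝔥 m) (trans (∗-·ʳ ½ 𝔹 𝕫 m) (cong (½ *_) (∗-𝕫ʳ 𝔹 m))) (trans (∗-𝕫ˡ 𝔥 m) (z·𝔥 m)) ⟩
    BB + ½ * zB + ½ * (zB + ½ * zz) + ℕ→ℚ m * (𝔹 m + ½ * 𝕫 m)
      ≡⟨ solve 6 (λ BB zB zz M B Z → BB :+ con ½ :* zB :+ con ½ :* (zB :+ con ½ :* zz) :+ M :* (B :+ con ½ :* Z)
                                       := (M :* B :+ (BB :+ zB)) :+ con ½ :* (M :* Z) :+ con ¼ :* zz) refl
           BB zB zz (ℕ→ℚ m) (𝔹 m) (𝕫 m) ⟩
    (θ 𝔹 m + (BB + zB)) + ½ * θ 𝕫 m + ¼ * zz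
      ≡⟨ cong₂ (λ x y → x + ½ * y + ¼ * zz) (𝔹-riccati m) (θ𝕫≈𝕫 m) ⟩
    𝔹 m + ½ * 𝕫 m + ¼ * zz ∎
    where
    BB = (𝔹 ∗ 𝔹) m
    zB = (z· 𝔹) m
    zz = (z· 𝕫) m
    z·𝔥 : ∀ m → (z· 𝔥) m ≡ (z· 𝔹) m + ½ * (z· 𝕫) m
    z·𝔥 zero = refl
    z·𝔥 (suc m) = refl

  -- Evenness of h and the recursion for its powers

  double : ℕ → ℕ
  double zero = zero
  double (suc n) = suc (suc (double n))

  double≡2* : ∀ n → double n ≡ 2 ℕ.* n
  double≡2* zero = refl
  double≡2* (suc n) = trans (cong (λ m → suc (suc m)) (double≡2* n)) (sym (ℕₚ.*-suc 2 n))

  double∸suc-double : ∀ {a t} → a < t → double t ∸ suc (double a) ≡ suc (double (t ∸ suc a))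
  double∸suc-double {zero} {suc t} _ = refl
  double∸suc-double {suc a} {suc t} a<t = double∸suc-double (s≤s⁻¹ a<t)

  Σ<-double : ∀ t g → Σ< (double t) g ≡ Σ< t (λ a → g (double a) + g (suc (double a)))
  Σ<-double zero g = refl
  Σ<-double (suc t) g = trans (sym (ℚₚ.+-assoc (g 0) (g 1) _)) (cong (g 0 + g 1 +_) (Σ<-double t (λ i → g (suc (suc i)))))

  *-cancelˡ-suc : ∀ k {x y} → ℕ→ℚ (suc k) * x ≡ ℕ→ℚ (suc k) * y → x ≡ y
  *-cancelˡ-suc k {x} {y} kx≡ky = begin
    x                            ≡⟨ sym (ℚₚ.*-identityˡ x) ⟩
    1ℚ * x                       ≡⟨ cong (_* x) (sym (invSuc-inverse k)) ⟩
    invSuc k * ℕ→ℚ (suc k) * x   ≡⟨ ℚₚ.*-assoc (invSuc k) (ℕ→ℚ (suc k)) x ⟩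
    invSuc k * (ℕ→ℚ (suc k) * x) ≡⟨ cong (invSuc k *_) kx≡ky ⟩
    invSuc k * (ℕ→ℚ (suc k) * y) ≡⟨ sym (ℚₚ.*-assoc (invSuc k) (ℕ→ℚ (suc k)) y) ⟩
    invSuc k * ℕ→ℚ (suc k) * y   ≡⟨ cong (_* y) (invSuc-inverse k) ⟩
    1ℚ * y                       ≡⟨ ℚₚ.*-identityˡ y ⟩
    y                            ∎

  -- At an odd index m the hypothesis reads 2 f(m) + (terms with a smaller odd index) + m f(m) = f(m).
  odd-coefficients-vanish : ∀ f → f 0 ≡ 1ℚ →
    (∀ t → (f ∗ f) (suc (double t)) + θ f (suc (double t)) ≡ f (suc (double t))) →
    ∀ t → f (suc (double t)) ≡ 0ℚ
  odd-coefficients-vanish f f0≡1 riccati = <-rec (λ t → f (suc (double t)) ≡ 0ℚ) step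
    where
    step : ∀ t → (∀ {s} → s < t → f (suc (double s)) ≡ 0ℚ) → f (suc (double t)) ≡ 0ℚ
    step t ih = *-cancelˡ-suc m (begin
      ℕ→ℚ (suc m) * x                   ≡⟨ cong (_* x) (ℕ→ℚ-suc m) ⟩
      (1ℚ + ℕ→ℚ m) * x                  ≡⟨ solve 2 (λ M x → (con 1ℚ :+ M) :* x := (x :+ x :+ M :* x) :- x) refl (ℕ→ℚ m) x ⟩
      (x + x + ℕ→ℚ m * x) - x           ≡⟨ cong (λ y → (y + ℕ→ℚ m * x) - x) (sym square-at-m) ⟩
      ((f ∗ f) m + ℕ→ℚ m * x) - x       ≡⟨ cong (_- x) (riccati t) ⟩
      x - x                             ≡⟨ ℚₚ.+-inverseʳ x ⟩
      0ℚ                                ≡⟨ sym (ℚₚ.*-zeroʳ (ℕ→ℚ (suc m))) ⟩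
      ℕ→ℚ (suc m) * 0ℚ                  ∎)
      where
      m = suc (double t)
      x = f m
      g : ℕ → ℚ
      g i = f (suc i) * f (double t ∸ i)
      middle-vanishes : Σ< (double t) g ≡ 0ℚ
      middle-vanishes = trans (Σ<-double t g) (Σ<-zero t _ pair-vanishes)
        where
        pair-vanishes : ∀ a → a < t → g (double a) + g (suc (double a)) ≡ 0ℚ
        pair-vanishes a a<t = begin
          f (suc (double a)) * f (double t ∸ double a) + f (suc (suc (double a))) * f (double t ∸ suc (double a))
            ≡⟨ cong₂ (λ u v → u * f (double t ∸ double a) + f (suc (suc (double a))) * f v) (ih a<t) (double∸suc-double a<t) ⟩
          0ℚ * f (double t ∸ double a) + f (suc (suc (double a))) * f (suc (double (t ∸ suc a)))
            ≡⟨ cong (λ v → 0ℚ * f (double t ∸ double a) + f (suc (suc (double a))) * v) (ih (ℕₚ.∸-monoʳ-< (s≤s z≤n) a<t)) ⟩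
          0ℚ * f (double t ∸ double a) + f (suc (suc (double a))) * 0ℚ
            ≡⟨ solve 2 (λ u v → con 0ℚ :* u :+ v :* con 0ℚ := con 0ℚ) refl (f (double t ∸ double a)) (f (suc (suc (double a)))) ⟩
          0ℚ ∎
      square-at-m : (f ∗ f) m ≡ x + x
      square-at-m = begin
        f 0 * x + (shift f ∗ f) (double t)
          ≡⟨ cong (f 0 * x +_) (trans (∗≡Σ (shift f) f (double t)) (Σ<-suc (double t) g)) ⟩
        f 0 * x + (Σ< (double t) g + x * f (double t ∸ double t))
          ≡⟨ cong₂ (λ u v → f 0 * x + (u + x * f v)) middle-vanishes (ℕₚ.n∸n≡0 (double t)) ⟩
        f 0 * x + (0ℚ + x * f 0)
          ≡⟨ cong (λ u → u * x + (0ℚ + x * u)) f0≡1 ⟩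
        1ℚ * x + (0ℚ + x * 1ℚ)
          ≡⟨ solve 1 (λ x → con 1ℚ :* x :+ (con 0ℚ :+ x :* con 1ℚ) := x :+ x) refl x ⟩
        x + x ∎

  𝔥-odd : ∀ t → 𝔥 (suc (double t)) ≡ 0ℚ
  𝔥-odd = odd-coefficients-vanish 𝔥 refl (λ t → trans (𝔥-riccati (suc (double t))) (z·𝕫-odd t))
    where
    z·𝕫-odd : ∀ t → 𝔥 (suc (double t)) + ¼ * 𝕫 (double t) ≡ 𝔥 (suc (double t))
    z·𝕫-odd zero = ℚₚ.+-identityʳ (𝔥 1)
    z·𝕫-odd (suc t) = solve 1 (λ x → x :+ con ¼ :* con 0ℚ := x) refl (𝔥 (suc (double (suc t))))

  𝔥-even : ∀ j → 𝔥 (double j) ≡ 𝔹 (double j)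
  𝔥-even zero = refl
  𝔥-even (suc j) = solve 1 (λ x → x :+ con ½ :* con 0ℚ := x) refl (𝔹 (double (suc j)))

  ∗-at-even : ∀ f g → (∀ t → f (suc (double t)) ≡ 0ℚ) →
    ∀ n → (f ∗ g) (double n) ≡ Σ< (suc n) (λ j → f (double j) * g (double (n ∸ j)))
  ∗-at-even f g odd≡0 zero = sym (ℚₚ.+-identityʳ (f 0 * g 0))
  ∗-at-even f g odd≡0 (suc n) = cong (f 0 * g (double (suc n)) +_) (begin
    f 1 * g (suc (double n)) + (shift (shift f) ∗ g) (double n)
      ≡⟨ cong₂ _+_ (trans (cong (_* g (suc (double n))) (odd≡0 0)) (ℚₚ.*-zeroˡ (g (suc (double n)))))
                   (∗-at-even (shift (shift f)) g (λ t → odd≡0 (suc t)) n) ⟩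
    0ℚ + Σ< (suc n) (λ j → f (double (suc j)) * g (double (n ∸ j)))
      ≡⟨ ℚₚ.+-identityˡ _ ⟩
    Σ< (suc n) (λ j → f (double (suc j)) * g (double (n ∸ j))) ∎)

  power : Series → ℕ → Series
  power f zero = 𝟙
  power f (suc N) = f ∗ power f N

  θ-power : ∀ f N → θ (power f (suc N)) ≈ ℕ→ℚ (suc N) · (θ f ∗ power f N)
  θ-power f zero m = begin
    ℕ→ℚ m * (f ∗ 𝟙) m            ≡⟨ cong (ℕ→ℚ m *_) (∗-identityʳ f m) ⟩
    ℕ→ℚ m * f m                  ≡⟨ sym (ℚₚ.*-identityˡ (ℕ→ℚ m * f m)) ⟩
    1ℚ * (ℕ→ℚ m * f m)           ≡⟨ cong (1ℚ *_) (sym (∗-identityʳ (θ f) m)) ⟩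
    1ℚ * (θ f ∗ 𝟙) m             ∎
  θ-power f (suc N) m = begin
    θ (f ∗ P) m                                 ≡⟨ θ-∗ f P m ⟩
    A + (f ∗ θ P) m                             ≡⟨ cong (A +_) (∗-congʳ f (θ-power f N) m) ⟩
    A + (f ∗ (c · (θ f ∗ power f N))) m         ≡⟨ cong (A +_) (∗-·ʳ c f (θ f ∗ power f N) m) ⟩
    A + c * (f ∗ (θ f ∗ power f N)) m           ≡⟨ cong (λ x → A + c * x) (∗-swapˡ f (θ f) (power f N) m) ⟩
    A + c * A                                   ≡⟨ solve 2 (λ a c → a :+ c :* a := (con 1ℚ :+ c) :* a) refl A c ⟩
    (1ℚ + c) * A                                ≡⟨ cong (_* A) (sym (ℕ→ℚ-suc (suc N))) ⟩
    ℕ→ℚ (suc (suc N)) * A                       ∎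
    where
    P = power f (suc N)
    c = ℕ→ℚ (suc N)
    A = (θ f ∗ P) m

  𝔥-power-rec : ∀ M m →
    ℕ→ℚ (suc M) * power 𝔥 (suc (suc M)) m + ℕ→ℚ m * power 𝔥 (suc M) m
      ≡ ℕ→ℚ (suc M) * power 𝔥 (suc M) m + ℕ→ℚ (suc M) * ¼ * (z· z· power 𝔥 M) m
  𝔥-power-rec M m = begin
    c * (𝔥 ∗ (𝔥 ∗ P)) m + θ (power 𝔥 (suc M)) m
      ≡⟨ cong₂ (λ x y → c * x + y) (sym (∗-assoc 𝔥 𝔥 P m)) (θ-power 𝔥 M m) ⟩
    c * ((𝔥 ∗ 𝔥) ∗ P) m + c * (θ 𝔥 ∗ P) m
      ≡⟨ sym (ℚₚ.*-distribˡ-+ c (((𝔥 ∗ 𝔥) ∗ P) m) ((θ 𝔥 ∗ P) m)) ⟩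
    c * (((𝔥 ∗ 𝔥) ∗ P) m + (θ 𝔥 ∗ P) m)
      ≡⟨ cong (c *_) (sym (∗-distribʳ-⊞ P (𝔥 ∗ 𝔥) (θ 𝔥) m)) ⟩
    c * ((𝔥 ∗ 𝔥 ⊞ θ 𝔥) ∗ P) m
      ≡⟨ cong (c *_) (∗-congˡ P 𝔥-riccati m) ⟩
    c * ((𝔥 ⊞ ¼ · z· 𝕫) ∗ P) m
      ≡⟨ cong (c *_) (∗-distribʳ-⊞ P 𝔥 (¼ · z· 𝕫) m) ⟩
    c * ((𝔥 ∗ P) m + ((¼ · z· 𝕫) ∗ P) m)
      ≡⟨ cong (λ x → c * ((𝔥 ∗ P) m + x)) (trans (∗-·ˡ ¼ (z· 𝕫) P m) (cong (¼ *_) z·𝕫∗P)) ⟩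
    c * ((𝔥 ∗ P) m + ¼ * (z· z· P) m)
      ≡⟨ solve 4 (λ c x q y → c :* (x :+ q :* y) := c :* x :+ c :* q :* y) refl c ((𝔥 ∗ P) m) ¼ ((z· z· P) m) ⟩
    c * power 𝔥 (suc M) m + c * ¼ * (z· z· P) m ∎
    where
    c = ℕ→ℚ (suc M)
    P = power 𝔥 M
    z·𝕫∗P : ((z· 𝕫) ∗ P) m ≡ (z· z· P) m
    z·𝕫∗P = trans (∗-z·ˡ 𝕫 P m) (cong-z· (∗-𝕫ˡ P) m)
      where
      cong-z· : ∀ {f g} → f ≈ g → z· f ≈ z· g
      cong-z· f≈g zero = refl
      cong-z· f≈g (suc k) = f≈g k

  -- Compositions as coefficients of powers

  sumℚ-map-*ˡ : ∀ {A : Set} c (w : A → ℚ) xs → sumℚ (map (λ x → c * w x) xs) ≡ c * sumℚ (map w xs)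
  sumℚ-map-*ˡ c w [] = sym (ℚₚ.*-zeroʳ c)
  sumℚ-map-*ˡ c w (x ∷ xs) = trans (cong (c * w x +_) (sumℚ-map-*ˡ c w xs)) (sym (ℚₚ.*-distribˡ-+ c (w x) (sumℚ (map w xs))))

  sumℚ-map-concatMap : ∀ {A B : Set} (w : B → ℚ) (F : A → List B) xs →
    sumℚ (map w (concatMap F xs)) ≡ sumℚ (map (λ x → sumℚ (map w (F x))) xs)
  sumℚ-map-concatMap w F [] = refl
  sumℚ-map-concatMap w F (x ∷ xs) = begin
    sumℚ (map w (F x ++ concatMap F xs))                ≡⟨ cong sumℚ (Listₚ.map-++ w (F x) (concatMap F xs)) ⟩
    sumℚ (map w (F x) ++ map w (concatMap F xs))        ≡⟨ sumℚ-++ (map w (F x)) (map w (concatMap F xs)) ⟩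
    sumℚ (map w (F x)) + sumℚ (map w (concatMap F xs))  ≡⟨ cong (sumℚ (map w (F x)) +_) (sumℚ-map-concatMap w F xs) ⟩
    sumℚ (map w (F x)) + sumℚ (map (λ x → sumℚ (map w (F x))) xs) ∎

  weightSum : ℕ → ℕ → ℚ
  weightSum N n = sumℚ (map weight (compositions N n))

  S≡weightSum : ∀ N n → S N n ≡ ℕ→ℚ ((2 ℕ.* n) !) * weightSum N n
  S≡weightSum N n = sumℚ-map-*ˡ (ℕ→ℚ ((2 ℕ.* n) !)) weight (compositions N n)

  weightSum-suc : ∀ N n → weightSum (suc N) n ≡ Σ< (suc n) (λ j → 𝔹 (2 ℕ.* j) * weightSum N (n ∸ j))
  weightSum-suc N n = begin
    weightSum (suc N) n
      ≡⟨ sumℚ-map-concatMap weight (λ j → map (j ∷_) (compositions N (n ∸ j))) (upTo (suc n)) ⟩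
    sumℚ (map (λ j → sumℚ (map weight (map (j ∷_) (compositions N (n ∸ j))))) (upTo (suc n)))
      ≡⟨ cong sumℚ (Listₚ.map-upTo (λ j → sumℚ (map weight (map (j ∷_) (compositions N (n ∸ j))))) (suc n)) ⟩
    Σ< (suc n) (λ j → sumℚ (map weight (map (j ∷_) (compositions N (n ∸ j)))))
      ≡⟨ Σ<-cong (suc n) (λ j _ → trans (cong sumℚ (sym (Listₚ.map-∘ {g = weight} {f = j ∷_} (compositions N (n ∸ j)))))
                                        (sumℚ-map-*ˡ (𝔹 (2 ℕ.* j)) weight (compositions N (n ∸ j)))) ⟩
    Σ< (suc n) (λ j → 𝔹 (2 ℕ.* j) * weightSum N (n ∸ j)) ∎

  weightSum≡𝔥-power : ∀ N n → weightSum N n ≡ power 𝔥 N (double n)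
  weightSum≡𝔥-power zero zero = refl
  weightSum≡𝔥-power zero (suc n) = refl
  weightSum≡𝔥-power (suc N) n = begin
    weightSum (suc N) n
      ≡⟨ weightSum-suc N n ⟩
    Σ< (suc n) (λ j → 𝔹 (2 ℕ.* j) * weightSum N (n ∸ j))
      ≡⟨ Σ<-cong (suc n) (λ j _ → cong₂ _*_ (trans (cong 𝔹 (sym (double≡2* j))) (sym (𝔥-even j))) (weightSum≡𝔥-power N (n ∸ j))) ⟩
    Σ< (suc n) (λ j → 𝔥 (double j) * power 𝔥 N (double (n ∸ j)))
      ≡⟨ sym (∗-at-even 𝔥 (power 𝔥 N) 𝔥-odd n) ⟩
    power 𝔥 (suc N) (double n) ∎

  -- Umbral evaluation

  umbralFrom-⊕ : ∀ k p q → umbralFrom k (p ⊕ q) ≡ umbralFrom k p + umbralFrom k q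
  umbralFrom-⊕ k [] q = sym (ℚₚ.+-identityˡ (umbralFrom k q))
  umbralFrom-⊕ k (a ∷ p) [] = sym (ℚₚ.+-identityʳ (umbralFrom k (a ∷ p)))
  umbralFrom-⊕ k (a ∷ p) (b ∷ q) = begin
    (a + b) * u + umbralFrom (suc k) (p ⊕ q)
      ≡⟨ cong ((a + b) * u +_) (umbralFrom-⊕ (suc k) p q) ⟩
    (a + b) * u + (umbralFrom (suc k) p + umbralFrom (suc k) q)
      ≡⟨ solve 5 (λ a b u x y → (a :+ b) :* u :+ (x :+ y) := (a :* u :+ x) :+ (b :* u :+ y)) refl
           a b u (umbralFrom (suc k) p) (umbralFrom (suc k) q) ⟩
    (a * u + umbralFrom (suc k) p) + (b * u + umbralFrom (suc k) q) ∎
    where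
    u = umbralCoeff k

  umbralFrom-⊙ : ∀ k c p → umbralFrom k (c ⊙ p) ≡ c * umbralFrom k p
  umbralFrom-⊙ k c [] = sym (ℚₚ.*-zeroʳ c)
  umbralFrom-⊙ k c (a ∷ p) = begin
    c * a * umbralCoeff k + umbralFrom (suc k) (c ⊙ p)   ≡⟨ cong (c * a * umbralCoeff k +_) (umbralFrom-⊙ (suc k) c p) ⟩
    c * a * umbralCoeff k + c * umbralFrom (suc k) p     ≡⟨ solve 4 (λ c a u x → c :* a :* u :+ c :* x := c :* (a :* u :+ x)) refl c a (umbralCoeff k) (umbralFrom (suc k) p) ⟩
    c * (a * umbralCoeff k + umbralFrom (suc k) p)       ∎

  umbralFrom-mulβ : ∀ k p → umbralFrom k (mulβ p) ≡ umbralFrom (suc k) p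
  umbralFrom-mulβ k p = trans (cong (_+ umbralFrom (suc k) p) (ℚₚ.*-zeroˡ (umbralCoeff k))) (ℚₚ.+-identityˡ (umbralFrom (suc k) p))

  umbralFrom-∷-⊛ : ∀ k a p q → umbralFrom k ((a ∷ p) ⊛ q) ≡ a * umbralFrom k q + umbralFrom (suc k) (p ⊛ q)
  umbralFrom-∷-⊛ k a p q = trans (umbralFrom-⊕ k (a ⊙ q) (mulβ (p ⊛ q))) (cong₂ _+_ (umbralFrom-⊙ k a q) (umbralFrom-mulβ k (p ⊛ q)))

  umbralFrom-βpow-⊛ : ∀ K k q → umbralFrom k (βpow K ⊛ q) ≡ umbralFrom (k ℕ.+ K) q
  umbralFrom-βpow-⊛ zero k q = begin
    umbralFrom k ((1ℚ ∷ []) ⊛ q)           ≡⟨ umbralFrom-∷-⊛ k 1ℚ [] q ⟩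
    1ℚ * umbralFrom k q + 0ℚ              ≡⟨ solve 1 (λ x → con 1ℚ :* x :+ con 0ℚ := x) refl (umbralFrom k q) ⟩
    umbralFrom k q                        ≡⟨ cong (λ i → umbralFrom i q) (sym (ℕₚ.+-identityʳ k)) ⟩
    umbralFrom (k ℕ.+ 0) q                ∎
  umbralFrom-βpow-⊛ (suc K) k q = begin
    umbralFrom k ((0ℚ ∷ βpow K) ⊛ q)                    ≡⟨ umbralFrom-∷-⊛ k 0ℚ (βpow K) q ⟩
    0ℚ * umbralFrom k q + umbralFrom (suc k) (βpow K ⊛ q) ≡⟨ cong (0ℚ * umbralFrom k q +_) (umbralFrom-βpow-⊛ K (suc k) q) ⟩
    0ℚ * umbralFrom k q + umbralFrom (suc k ℕ.+ K) q     ≡⟨ solve 2 (λ x y → con 0ℚ :* x :+ y := y) refl (umbralFrom k q) (umbralFrom (suc k ℕ.+ K) q) ⟩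
    umbralFrom (suc k ℕ.+ K) q                          ≡⟨ cong (λ i → umbralFrom i q) (sym (ℕₚ.+-suc k K)) ⟩
    umbralFrom (k ℕ.+ suc K) q                          ∎

  umbralFrom-sumPoly : ∀ k n F → umbralFrom k (sumPoly (applyUpTo F n)) ≡ Σ< n (λ ℓ → umbralFrom k (F ℓ))
  umbralFrom-sumPoly k zero F = refl
  umbralFrom-sumPoly k (suc n) F = trans (umbralFrom-⊕ k (F 0) (sumPoly (applyUpTo (λ i → F (suc i)) n)))
    (cong (umbralFrom k (F 0) +_) (umbralFrom-sumPoly k n (λ i → F (suc i))))

  umbralFrom-⊛-βplus : ∀ k c p → umbralFrom k (p ⊛ βplus c) ≡ c * umbralFrom k p + umbralFrom (suc k) p
  umbralFrom-⊛-βplus k c [] = solve 1 (λ c → con 0ℚ := c :* con 0ℚ :+ con 0ℚ) refl c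
  umbralFrom-⊛-βplus k c (a ∷ p) = begin
    umbralFrom k ((a ∷ p) ⊛ βplus c)
      ≡⟨ umbralFrom-∷-⊛ k a p (βplus c) ⟩
    a * umbralFrom k (βplus c) + umbralFrom (suc k) (p ⊛ βplus c)
      ≡⟨ cong (a * umbralFrom k (βplus c) +_) (umbralFrom-⊛-βplus (suc k) c p) ⟩
    a * (c * u₀ + (1ℚ * u₁ + 0ℚ)) + (c * umbralFrom (suc k) p + umbralFrom (suc (suc k)) p)
      ≡⟨ solve 6 (λ a c u₀ u₁ x y → a :* (c :* u₀ :+ (con 1ℚ :* u₁ :+ con 0ℚ)) :+ (c :* x :+ y) := c :* (a :* u₀ :+ x) :+ (a :* u₁ :+ y)) refl
           a c u₀ u₁ (umbralFrom (suc k) p) (umbralFrom (suc (suc k)) p) ⟩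
    c * (a * u₀ + umbralFrom (suc k) p) + (a * u₁ + umbralFrom (suc (suc k)) p) ∎
    where
    u₀ = umbralCoeff k
    u₁ = umbralCoeff (suc k)

  pochMoment : ℕ → ℕ → ℚ
  pochMoment k ℓ = umbralFrom k (poch ℓ)

  pochMoment-suc : ∀ k ℓ → pochMoment k (suc ℓ) ≡ ℕ→ℚ (suc ℓ) * pochMoment k ℓ + pochMoment (suc k) ℓ
  pochMoment-suc k ℓ = umbralFrom-⊛-βplus k (ℕ→ℚ (suc ℓ)) (poch ℓ)

  rhsCoeff : ℕ → ℕ → ℚ
  rhsCoeff N ℓ = ℕ→ℚ (N C suc ℓ) * sign ℓ * inv2^ (N ∸ 1 ∸ ℓ) * inv! ℓ

  rhsSum : ℕ → ℕ → ℚ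
  rhsSum N k = Σ< N (λ ℓ → rhsCoeff N ℓ * pochMoment k ℓ)

  umbral-rhsPoly : ∀ N n → umbral (rhsPoly N n) ≡ (ℕ→ℚ ((2 ℕ.* n) !) * inv! (2 ℕ.* n ∸ N)) * rhsSum N (2 ℕ.* n ∸ N ℕ.+ 1)
  umbral-rhsPoly N n = begin
    umbralFrom 0 (c ⊙ (βpow K ⊛ s))        ≡⟨ umbralFrom-⊙ 0 c (βpow K ⊛ s) ⟩
    c * umbralFrom 0 (βpow K ⊛ s)          ≡⟨ cong (c *_) (umbralFrom-βpow-⊛ K 0 s) ⟩
    c * umbralFrom K s                     ≡⟨ cong (c *_) (umbralFrom-sumPoly K N (λ ℓ → rhsCoeff N ℓ ⊙ poch ℓ)) ⟩
    c * Σ< N (λ ℓ → umbralFrom K (rhsCoeff N ℓ ⊙ poch ℓ))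
                                           ≡⟨ cong (c *_) (Σ<-cong N (λ ℓ _ → umbralFrom-⊙ K (rhsCoeff N ℓ) (poch ℓ))) ⟩
    c * rhsSum N K                         ∎
    where
    c = ℕ→ℚ ((2 ℕ.* n) !) * inv! (2 ℕ.* n ∸ N)
    K = 2 ℕ.* n ∸ N ℕ.+ 1
    s = sumPoly (applyUpTo (λ ℓ → rhsCoeff N ℓ ⊙ poch ℓ) N)

  -- The coefficients of the closed form

  scaledCoeff : ℕ → ℕ → ℚ
  scaledCoeff N ℓ = ℕ→ℚ (N C suc ℓ) * sign ℓ * ℕ→ℚ (2 ^ suc ℓ) * inv! ℓ

  scaledCoeff-vanishes : ∀ {N ℓ} → N ≤ ℓ → scaledCoeff N ℓ ≡ 0ℚ
  scaledCoeff-vanishes {N} {ℓ} N≤ℓ = begin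
    ℕ→ℚ (N C suc ℓ) * sign ℓ * ℕ→ℚ (2 ^ suc ℓ) * inv! ℓ   ≡⟨ cong (λ x → ℕ→ℚ x * sign ℓ * ℕ→ℚ (2 ^ suc ℓ) * inv! ℓ) (k>n⇒nCk≡0 (s≤s N≤ℓ)) ⟩
    0ℚ * sign ℓ * ℕ→ℚ (2 ^ suc ℓ) * inv! ℓ                 ≡⟨ solve 3 (λ a b c → con 0ℚ :* a :* b :* c := con 0ℚ) refl (sign ℓ) (ℕ→ℚ (2 ^ suc ℓ)) (inv! ℓ) ⟩
    0ℚ                                                     ∎

  -- Pulling out 2^(−N) removes the truncated subtraction in the exponent of rhsCoeff.
  rhsCoeff≡inv2^*scaledCoeff : ∀ N ℓ → rhsCoeff N ℓ ≡ inv2^ N * scaledCoeff N ℓ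
  rhsCoeff≡inv2^*scaledCoeff N ℓ with ℕₚ.<-≤-connex ℓ N
  ... | inj₁ ℓ<N = begin
    ℕ→ℚ (N C suc ℓ) * sign ℓ * inv2^ (N ∸ 1 ∸ ℓ) * inv! ℓ
      ≡⟨ cong (λ x → ℕ→ℚ (N C suc ℓ) * sign ℓ * x * inv! ℓ) inv2^-exponent ⟩
    ℕ→ℚ (N C suc ℓ) * sign ℓ * (inv2^ N * ℕ→ℚ (2 ^ suc ℓ)) * inv! ℓ
      ≡⟨ solve 5 (λ C s v p f → C :* s :* (v :* p) :* f := v :* (C :* s :* p :* f)) refl
           (ℕ→ℚ (N C suc ℓ)) (sign ℓ) (inv2^ N) (ℕ→ℚ (2 ^ suc ℓ)) (inv! ℓ) ⟩
    inv2^ N * scaledCoeff N ℓ ∎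
    where
    inv2^-exponent : inv2^ (N ∸ 1 ∸ ℓ) ≡ inv2^ N * ℕ→ℚ (2 ^ suc ℓ)
    inv2^-exponent = begin
      inv2^ (N ∸ 1 ∸ ℓ)                                ≡⟨ cong inv2^ (ℕₚ.∸-+-assoc N 1 ℓ) ⟩
      inv2^ (N ∸ suc ℓ)                                ≡⟨ sym (inv2^-+ (N ∸ suc ℓ) (suc ℓ)) ⟩
      inv2^ (N ∸ suc ℓ ℕ.+ suc ℓ) * ℕ→ℚ (2 ^ suc ℓ)    ≡⟨ cong (λ m → inv2^ m * ℕ→ℚ (2 ^ suc ℓ)) (ℕₚ.m∸n+n≡m ℓ<N) ⟩
      inv2^ N * ℕ→ℚ (2 ^ suc ℓ)                        ∎
  ... | inj₂ N≤ℓ = begin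
    ℕ→ℚ (N C suc ℓ) * sign ℓ * inv2^ (N ∸ 1 ∸ ℓ) * inv! ℓ
      ≡⟨ cong (λ x → ℕ→ℚ x * sign ℓ * inv2^ (N ∸ 1 ∸ ℓ) * inv! ℓ) (k>n⇒nCk≡0 (s≤s N≤ℓ)) ⟩
    0ℚ * sign ℓ * inv2^ (N ∸ 1 ∸ ℓ) * inv! ℓ
      ≡⟨ solve 4 (λ a b c v → con 0ℚ :* a :* b :* c := v :* con 0ℚ) refl (sign ℓ) (inv2^ (N ∸ 1 ∸ ℓ)) (inv! ℓ) (inv2^ N) ⟩
    inv2^ N * 0ℚ
      ≡⟨ cong (inv2^ N *_) (sym (scaledCoeff-vanishes N≤ℓ)) ⟩
    inv2^ N * scaledCoeff N ℓ ∎

  scaledCoeff↓ : ℕ → ℕ → ℚ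
  scaledCoeff↓ N zero = 0ℚ
  scaledCoeff↓ N (suc ℓ) = scaledCoeff N ℓ

  -- Divided by (−1)^ℓ 2^(ℓ+1) / ℓ!, this is [1+M]*[2+M]C[1+k]-expand at k = ℓ.
  scaledCoeff-rec : ∀ M ℓ →
    ℕ→ℚ (suc M) * scaledCoeff (suc (suc M)) ℓ + ℕ→ℚ 2 * scaledCoeff↓ (suc M) ℓ
      ≡ ℕ→ℚ 2 * (ℕ→ℚ (suc ℓ) * scaledCoeff (suc M) ℓ) + ℕ→ℚ (suc M) * scaledCoeff M ℓ
  scaledCoeff-rec M zero = begin
    c * (C₂ * 1ℚ * two * 1ℚ) + two * 0ℚ
      ≡⟨ solve 3 (λ c C₂ two → c :* (C₂ :* con 1ℚ :* two :* con 1ℚ) :+ two :* con 0ℚ := (c :* C₂) :* two) refl c C₂ two ⟩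
    (c * C₂) * two
      ≡⟨ cong (_* two) ([1+M]*[2+M]C[1+k]-expandℚ M 0) ⟩
    (0ℚ * ℕ→ℚ (suc M C 0) + two * (1ℚ * C₁) + c * C₀) * two
      ≡⟨ solve 5 (λ x C₁ C₀ c two → (con 0ℚ :* x :+ two :* (con 1ℚ :* C₁) :+ c :* C₀) :* two
                                    := two :* (con 1ℚ :* (C₁ :* con 1ℚ :* two :* con 1ℚ)) :+ c :* (C₀ :* con 1ℚ :* two :* con 1ℚ)) refl
           (ℕ→ℚ (suc M C 0)) C₁ C₀ c two ⟩
    two * (1ℚ * (C₁ * 1ℚ * two * 1ℚ)) + c * (C₀ * 1ℚ * two * 1ℚ) ∎
    where
    c = ℕ→ℚ (suc M)
    two = ℕ→ℚ 2
    C₂ = ℕ→ℚ (suc (suc M) C 1)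
    C₁ = ℕ→ℚ (suc M C 1)
    C₀ = ℕ→ℚ (M C 1)
  scaledCoeff-rec M (suc l) = begin
    c * (C₂ * - s * ℕ→ℚ (2 ℕ.* P) * f′) + two * (C₁′ * s * ℕ→ℚ P * inv! l)
      ≡⟨ cong₂ (λ x y → c * (C₂ * - s * x * f′) + two * (C₁′ * s * ℕ→ℚ P * y)) (ℕ→ℚ-* 2 P) (inv!-pred l) ⟩
    c * (C₂ * - s * (two * p) * f′) + two * (C₁′ * s * p * (L * f′))
      ≡⟨ solve 8 (λ c C₂ s two p f′ C₁′ L → c :* (C₂ :* :- s :* (two :* p) :* f′) :+ two :* (C₁′ :* s :* p :* (L :* f′))
                                           := (c :* C₂) :* (:- (two :* s :* p :* f′)) :+ two :* s :* p :* f′ :* L :* C₁′) refl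
           c C₂ s two p f′ C₁′ L ⟩
    (c * C₂) * - (two * s * p * f′) + two * s * p * f′ * L * C₁′
      ≡⟨ cong (λ x → x * - (two * s * p * f′) + two * s * p * f′ * L * C₁′) ([1+M]*[2+M]C[1+k]-expandℚ M (suc l)) ⟩
    (L * C₁′ + two * (L₂ * C₁) + c * C₀) * - (two * s * p * f′) + two * s * p * f′ * L * C₁′
      ≡⟨ solve 10 (λ c C₁′ C₁ C₀ L L₂ s two p f′ →
                   (L :* C₁′ :+ two :* (L₂ :* C₁) :+ c :* C₀) :* (:- (two :* s :* p :* f′)) :+ two :* s :* p :* f′ :* L :* C₁′
                   := two :* (L₂ :* (C₁ :* :- s :* (two :* p) :* f′)) :+ c :* (C₀ :* :- s :* (two :* p) :* f′)) refl
           c C₁′ C₁ C₀ L L₂ s two p f′ ⟩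
    two * (L₂ * (C₁ * - s * (two * p) * f′)) + c * (C₀ * - s * (two * p) * f′)
      ≡⟨ cong (λ x → two * (L₂ * (C₁ * - s * x * f′)) + c * (C₀ * - s * x * f′)) (sym (ℕ→ℚ-* 2 P)) ⟩
    two * (L₂ * (C₁ * - s * ℕ→ℚ (2 ℕ.* P) * f′)) + c * (C₀ * - s * ℕ→ℚ (2 ℕ.* P) * f′) ∎
    where
    c = ℕ→ℚ (suc M)
    two = ℕ→ℚ 2
    P = 2 ^ suc l
    p = ℕ→ℚ P
    s = sign l
    f′ = inv! (suc l)
    L = ℕ→ℚ (suc l)
    L₂ = ℕ→ℚ (suc (suc l))
    C₂ = ℕ→ℚ (suc (suc M) C suc (suc l))
    C₁′ = ℕ→ℚ (suc M C suc l)
    C₁ = ℕ→ℚ (suc M C suc (suc l))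
    C₀ = ℕ→ℚ (M C suc (suc l))

  scaledSum : ℕ → ℕ → ℚ
  scaledSum N k = Σ< N (λ ℓ → scaledCoeff N ℓ * pochMoment k ℓ)

  rhsSum≡inv2^*scaledSum : ∀ N k → rhsSum N k ≡ inv2^ N * scaledSum N k
  rhsSum≡inv2^*scaledSum N k = begin
    Σ< N (λ ℓ → rhsCoeff N ℓ * pochMoment k ℓ)
      ≡⟨ Σ<-cong N (λ ℓ _ → trans (cong (_* pochMoment k ℓ) (rhsCoeff≡inv2^*scaledCoeff N ℓ))
                                  (ℚₚ.*-assoc (inv2^ N) (scaledCoeff N ℓ) (pochMoment k ℓ))) ⟩
    Σ< N (λ ℓ → inv2^ N * (scaledCoeff N ℓ * pochMoment k ℓ))
      ≡⟨ Σ<-*ˡ N (inv2^ N) (λ ℓ → scaledCoeff N ℓ * pochMoment k ℓ) ⟩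
    inv2^ N * scaledSum N k ∎

  scaledSum-suc : ∀ N k →
    scaledSum N (suc k) + Σ< (suc N) (λ ℓ → ℕ→ℚ (suc ℓ) * scaledCoeff N ℓ * pochMoment k ℓ)
      ≡ Σ< (suc N) (λ ℓ → scaledCoeff↓ N ℓ * pochMoment k ℓ)
  scaledSum-suc N k = begin
    scaledSum N (suc k) + Σ< (suc N) C
      ≡⟨ cong (scaledSum N (suc k) +_) (trans (Σ<-suc N C) (trans (cong (Σ< N C +_) last-vanishes) (ℚₚ.+-identityʳ (Σ< N C)))) ⟩
    scaledSum N (suc k) + Σ< N C
      ≡⟨ sym (Σ<-+ N (λ ℓ → scaledCoeff N ℓ * pochMoment (suc k) ℓ) C) ⟩
    Σ< N (λ ℓ → scaledCoeff N ℓ * pochMoment (suc k) ℓ + C ℓ)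
      ≡⟨ Σ<-cong N (λ ℓ _ → sym (moment-shift ℓ)) ⟩
    Σ< N (λ ℓ → scaledCoeff N ℓ * pochMoment k (suc ℓ))
      ≡⟨ sym (trans (cong (_+ Σ< N (λ ℓ → scaledCoeff N ℓ * pochMoment k (suc ℓ))) (ℚₚ.*-zeroˡ (pochMoment k 0))) (ℚₚ.+-identityˡ _)) ⟩
    Σ< (suc N) (λ ℓ → scaledCoeff↓ N ℓ * pochMoment k ℓ) ∎
    where
    C : ℕ → ℚ
    C ℓ = ℕ→ℚ (suc ℓ) * scaledCoeff N ℓ * pochMoment k ℓ
    last-vanishes : C N ≡ 0ℚ
    last-vanishes = begin
      ℕ→ℚ (suc N) * scaledCoeff N N * pochMoment k N   ≡⟨ cong (λ x → ℕ→ℚ (suc N) * x * pochMoment k N) (scaledCoeff-vanishes {N} {N} ℕₚ.≤-refl) ⟩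
      ℕ→ℚ (suc N) * 0ℚ * pochMoment k N                ≡⟨ solve 2 (λ a b → a :* con 0ℚ :* b := con 0ℚ) refl (ℕ→ℚ (suc N)) (pochMoment k N) ⟩
      0ℚ                                               ∎
    moment-shift : ∀ ℓ → scaledCoeff N ℓ * pochMoment k (suc ℓ) ≡ scaledCoeff N ℓ * pochMoment (suc k) ℓ + C ℓ
    moment-shift ℓ = begin
      scaledCoeff N ℓ * pochMoment k (suc ℓ)
        ≡⟨ cong (scaledCoeff N ℓ *_) (pochMoment-suc k ℓ) ⟩
      scaledCoeff N ℓ * (ℕ→ℚ (suc ℓ) * pochMoment k ℓ + pochMoment (suc k) ℓ)
        ≡⟨ solve 4 (λ a L x y → a :* (L :* x :+ y) := a :* y :+ L :* a :* x) refl (scaledCoeff N ℓ) (ℕ→ℚ (suc ℓ)) (pochMoment k ℓ) (pochMoment (suc k) ℓ) ⟩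
      scaledCoeff N ℓ * pochMoment (suc k) ℓ + C ℓ ∎

  scaledSum-extend : ∀ N d k → Σ< (N ℕ.+ d) (λ ℓ → scaledCoeff N ℓ * pochMoment k ℓ) ≡ scaledSum N k
  scaledSum-extend N d k = Σ<-extend N d (λ ℓ → scaledCoeff N ℓ * pochMoment k ℓ)
    (λ ℓ N≤ℓ → trans (cong (_* pochMoment k ℓ) (scaledCoeff-vanishes N≤ℓ)) (ℚₚ.*-zeroˡ (pochMoment k ℓ)))

  scaledSum-rec : ∀ M k →
    ℕ→ℚ (suc M) * scaledSum (suc (suc M)) k + ℕ→ℚ 2 * scaledSum (suc M) (suc k) ≡ ℕ→ℚ (suc M) * scaledSum M k
  scaledSum-rec M k = begin
    c * ΣA + two * ŝ
      ≡⟨ solve 5 (λ c a two s x → c :* a :+ two :* s := (c :* a :+ two :* (s :+ x)) :- two :* x) refl c ΣA two ŝ (Σ< (suc N) C) ⟩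
    (c * ΣA + two * (ŝ + Σ< (suc N) C)) - two * Σ< (suc N) C
      ≡⟨ cong (λ x → (c * ΣA + two * x) - two * Σ< (suc N) C) (scaledSum-suc N k) ⟩
    (c * ΣA + two * Σ< (suc N) B) - two * Σ< (suc N) C
      ≡⟨ cong (_- two * Σ< (suc N) C) summed-rec ⟩
    (two * Σ< (suc N) C + c * Σ< (suc N) D) - two * Σ< (suc N) C
      ≡⟨ cong (λ x → (two * Σ< (suc N) C + c * x) - two * Σ< (suc N) C) (trans (cong (λ n → Σ< n D) (ℕₚ.+-comm 2 M)) (scaledSum-extend M 2 k)) ⟩
    (two * Σ< (suc N) C + c * scaledSum M k) - two * Σ< (suc N) C
      ≡⟨ solve 2 (λ x y → (x :+ y) :- x := y) refl (two * Σ< (suc N) C) (c * scaledSum M k) ⟩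
    c * scaledSum M k ∎
    where
    N = suc M
    c = ℕ→ℚ N
    two = ℕ→ℚ 2
    V = pochMoment k
    A B C D : ℕ → ℚ
    A ℓ = scaledCoeff (suc N) ℓ * V ℓ
    B ℓ = scaledCoeff↓ N ℓ * V ℓ
    C ℓ = ℕ→ℚ (suc ℓ) * scaledCoeff N ℓ * V ℓ
    D ℓ = scaledCoeff M ℓ * V ℓ
    ΣA = scaledSum (suc N) k
    ŝ = scaledSum N (suc k)
    summed-rec : c * ΣA + two * Σ< (suc N) B ≡ two * Σ< (suc N) C + c * Σ< (suc N) D
    summed-rec = begin
      c * ΣA + two * Σ< (suc N) B
        ≡⟨ sym (cong₂ _+_ (Σ<-*ˡ (suc N) c A) (Σ<-*ˡ (suc N) two B)) ⟩
      Σ< (suc N) (λ ℓ → c * A ℓ) + Σ< (suc N) (λ ℓ → two * B ℓ)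
        ≡⟨ sym (Σ<-+ (suc N) (λ ℓ → c * A ℓ) (λ ℓ → two * B ℓ)) ⟩
      Σ< (suc N) (λ ℓ → c * A ℓ + two * B ℓ)
        ≡⟨ Σ<-cong (suc N) (λ ℓ _ → pointwise ℓ) ⟩
      Σ< (suc N) (λ ℓ → two * C ℓ + c * D ℓ)
        ≡⟨ Σ<-+ (suc N) (λ ℓ → two * C ℓ) (λ ℓ → c * D ℓ) ⟩
      Σ< (suc N) (λ ℓ → two * C ℓ) + Σ< (suc N) (λ ℓ → c * D ℓ)
        ≡⟨ cong₂ _+_ (Σ<-*ˡ (suc N) two C) (Σ<-*ˡ (suc N) c D) ⟩
      two * Σ< (suc N) C + c * Σ< (suc N) D ∎
      where
      pointwise : ∀ ℓ → c * A ℓ + two * B ℓ ≡ two * C ℓ + c * D ℓ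
      pointwise ℓ = begin
        c * (scaledCoeff (suc N) ℓ * V ℓ) + two * (scaledCoeff↓ N ℓ * V ℓ)
          ≡⟨ solve 5 (λ c a two b v → c :* (a :* v) :+ two :* (b :* v) := (c :* a :+ two :* b) :* v) refl c (scaledCoeff (suc N) ℓ) two (scaledCoeff↓ N ℓ) (V ℓ) ⟩
        (c * scaledCoeff (suc N) ℓ + two * scaledCoeff↓ N ℓ) * V ℓ
          ≡⟨ cong (_* V ℓ) (scaledCoeff-rec M ℓ) ⟩
        (two * (ℕ→ℚ (suc ℓ) * scaledCoeff N ℓ) + c * scaledCoeff M ℓ) * V ℓ
          ≡⟨ solve 6 (λ two L a c b v → (two :* (L :* a) :+ c :* b) :* v := two :* (L :* a :* v) :+ c :* (b :* v)) refl
               two (ℕ→ℚ (suc ℓ)) (scaledCoeff N ℓ) c (scaledCoeff M ℓ) (V ℓ) ⟩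
        two * C ℓ + c * D ℓ ∎

  rhsSum-rec : ∀ M k → ℕ→ℚ (suc M) * rhsSum (suc (suc M)) k + rhsSum (suc M) (suc k) ≡ ℕ→ℚ (suc M) * ¼ * rhsSum M k
  rhsSum-rec M k = begin
    c * rhsSum (suc (suc M)) k + rhsSum (suc M) (suc k)
      ≡⟨ cong₂ (λ x y → c * x + y) (rhsSum≡inv2^*scaledSum (suc (suc M)) k) (rhsSum≡inv2^*scaledSum (suc M) (suc k)) ⟩
    c * (inv2^ (suc (suc M)) * s₂) + inv2^ (suc M) * s₁
      ≡⟨ cong₂ (λ x y → c * (x * s₂) + y * s₁) (trans (inv2^-suc (suc M)) (cong (_* ½) (inv2^-suc M))) (inv2^-suc M) ⟩
    c * (inv2^ M * ½ * ½ * s₂) + inv2^ M * ½ * s₁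
      ≡⟨ solve 4 (λ c i s₂ s₁ → c :* (i :* con ½ :* con ½ :* s₂) :+ i :* con ½ :* s₁ := i :* con ¼ :* (c :* s₂ :+ con (ℕ→ℚ 2) :* s₁)) refl c (inv2^ M) s₂ s₁ ⟩
    inv2^ M * ¼ * (c * s₂ + ℕ→ℚ 2 * s₁)
      ≡⟨ cong (inv2^ M * ¼ *_) (scaledSum-rec M k) ⟩
    inv2^ M * ¼ * (c * scaledSum M k)
      ≡⟨ solve 3 (λ i c s → i :* con ¼ :* (c :* s) := c :* con ¼ :* (i :* s)) refl (inv2^ M) c (scaledSum M k) ⟩
    c * ¼ * (inv2^ M * scaledSum M k)
      ≡⟨ cong (c * ¼ *_) (sym (rhsSum≡inv2^*scaledSum M k)) ⟩
    c * ¼ * rhsSum M k ∎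
    where
    c = ℕ→ℚ (suc M)
    s₂ = scaledSum (suc (suc M)) k
    s₁ = scaledSum (suc M) (suc k)

  weightSum-rec : ∀ M n →
    ℕ→ℚ (suc M) * weightSum (suc (suc M)) (suc n) + ℕ→ℚ (double (suc n)) * weightSum (suc M) (suc n)
      ≡ ℕ→ℚ (suc M) * weightSum (suc M) (suc n) + ℕ→ℚ (suc M) * ¼ * weightSum M n
  weightSum-rec M n = begin
    c * weightSum (suc (suc M)) (suc n) + D * weightSum (suc M) (suc n)
      ≡⟨ cong₂ (λ x y → c * x + D * y) (weightSum≡𝔥-power (suc (suc M)) (suc n)) (weightSum≡𝔥-power (suc M) (suc n)) ⟩
    c * power 𝔥 (suc (suc M)) (double (suc n)) + D * power 𝔥 (suc M) (double (suc n))
      ≡⟨ 𝔥-power-rec M (double (suc n)) ⟩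
    c * power 𝔥 (suc M) (double (suc n)) + c * ¼ * power 𝔥 M (double n)
      ≡⟨ sym (cong₂ (λ x y → c * x + c * ¼ * y) (weightSum≡𝔥-power (suc M) (suc n)) (weightSum≡𝔥-power M n)) ⟩
    c * weightSum (suc M) (suc n) + c * ¼ * weightSum M n ∎
    where
    c = ℕ→ℚ (suc M)
    D = ℕ→ℚ (double (suc n))

  weightSum≡rhsSum-step : ∀ M n r → suc M ℕ.+ suc (suc r) ≡ double (suc n) →
    weightSum (suc M) (suc n) ≡ inv! (suc (suc r)) * rhsSum (suc M) (suc (suc (suc r))) →
    weightSum M n ≡ inv! (suc r) * rhsSum M (suc (suc r)) →
    weightSum (suc (suc M)) (suc n) ≡ inv! (suc r) * rhsSum (suc (suc M)) (suc (suc r))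
  weightSum≡rhsSum-step M n r eq ih₁ ih₀ = *-cancelˡ-suc M (begin
    c * w₂
      ≡⟨ solve 4 (λ c e w₂ w₁ → c :* w₂ := (c :* w₂ :+ (c :+ e) :* w₁) :- c :* w₁ :- e :* w₁) refl c e w₂ w₁ ⟩
    (c * w₂ + (c + e) * w₁) - c * w₁ - e * w₁
      ≡⟨ cong (λ x → (c * w₂ + x * w₁) - c * w₁ - e * w₁) (sym D≡c+e) ⟩
    (c * w₂ + D * w₁) - c * w₁ - e * w₁
      ≡⟨ cong (λ x → x - c * w₁ - e * w₁) (weightSum-rec M n) ⟩
    (c * w₁ + c * ¼ * w₀) - c * w₁ - e * w₁
      ≡⟨ cong₂ (λ x y → (c * w₁ + c * ¼ * x) - c * w₁ - e * y) ih₀ ih₁ ⟩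
    (c * w₁ + c * ¼ * (f * t₀)) - c * w₁ - e * (f′ * t₁)
      ≡⟨ solve 7 (λ c w₁ f t₀ e f′ t₁ → (c :* w₁ :+ c :* con ¼ :* (f :* t₀)) :- c :* w₁ :- e :* (f′ :* t₁) := f :* (c :* con ¼ :* t₀) :- (e :* f′) :* t₁) refl
           c w₁ f t₀ e f′ t₁ ⟩
    f * (c * ¼ * t₀) - (e * f′) * t₁
      ≡⟨ cong₂ (λ x y → f * x - y * t₁) (sym (rhsSum-rec M (suc (suc r)))) (sym (inv!-pred (suc r))) ⟩
    f * (c * t₂ + t₁) - f * t₁
      ≡⟨ solve 4 (λ f c t₂ t₁ → f :* (c :* t₂ :+ t₁) :- f :* t₁ := c :* (f :* t₂)) refl f c t₂ t₁ ⟩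
    c * (f * t₂) ∎)
    where
    c = ℕ→ℚ (suc M)
    e = ℕ→ℚ (suc (suc r))
    D = ℕ→ℚ (double (suc n))
    f = inv! (suc r)
    f′ = inv! (suc (suc r))
    w₂ = weightSum (suc (suc M)) (suc n)
    w₁ = weightSum (suc M) (suc n)
    w₀ = weightSum M n
    t₂ = rhsSum (suc (suc M)) (suc (suc r))
    t₁ = rhsSum (suc M) (suc (suc (suc r)))
    t₀ = rhsSum M (suc (suc r))
    D≡c+e : D ≡ c + e
    D≡c+e = trans (cong ℕ→ℚ (sym eq)) (ℕ→ℚ-+ (suc M) (suc (suc r)))

  weightSum≡rhsSum : ∀ N n r → N ℕ.+ suc r ≡ double n → weightSum N n ≡ inv! (suc r) * rhsSum N (suc (suc r))
  weightSum≡rhsSum zero (suc n) r _ = sym (ℚₚ.*-zeroʳ (inv! (suc r)))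
  weightSum≡rhsSum (suc zero) (suc n) r refl = begin
    weightSum 1 (suc n)                          ≡⟨ weightSum≡𝔥-power 1 (suc n) ⟩
    (𝔥 ∗ 𝟙) (double (suc n))                     ≡⟨ ∗-identityʳ 𝔥 (double (suc n)) ⟩
    𝔥 (double (suc n))                           ≡⟨ 𝔥-even (suc n) ⟩
    bernoulli (suc (suc r)) * inv! (suc (suc r)) ≡⟨ cong (bernoulli (suc (suc r)) *_) (inv!-suc (suc r)) ⟩
    bernoulli (suc (suc r)) * (inv! (suc r) * invSuc (suc r))
      ≡⟨ solve 3 (λ b i v → b :* (i :* v) := i :* (con 1ℚ :* (con 1ℚ :* (b :* v) :+ con 0ℚ) :+ con 0ℚ)) refl
           (bernoulli (suc (suc r))) (inv! (suc r)) (invSuc (suc r)) ⟩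
    inv! (suc r) * rhsSum 1 (suc (suc r)) ∎
  weightSum≡rhsSum (suc (suc M)) (suc n) r eq = weightSum≡rhsSum-step M n r eq₁
    (weightSum≡rhsSum (suc M) (suc n) (suc r) eq₁)
    (weightSum≡rhsSum M n r (ℕₚ.suc-injective (ℕₚ.suc-injective eq)))
    where
    eq₁ : suc M ℕ.+ suc (suc r) ≡ double (suc n)
    eq₁ = trans (cong suc (ℕₚ.+-suc M (suc r))) eq

  S≡umbral-rhsPoly : ∀ N n → N < 2 ℕ.* n → S N n ≡ umbral (rhsPoly N n)
  S≡umbral-rhsPoly N n N<2n with ℕₚ.m≤n⇒∃[o]m+o≡n N<2n
  ... | r , N+1+r≡2n = begin
    S N n                                                ≡⟨ S≡weightSum N n ⟩
    [2n]! * weightSum N n                                ≡⟨ cong ([2n]! *_) (weightSum≡rhsSum N n r N+[1+r]≡double) ⟩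
    [2n]! * (inv! (suc r) * rhsSum N (suc (suc r)))      ≡⟨ cong (λ k → [2n]! * (inv! (suc r) * rhsSum N k)) (ℕₚ.+-comm 1 (suc r)) ⟩
    [2n]! * (inv! (suc r) * rhsSum N (suc r ℕ.+ 1))      ≡⟨ cong (λ k → [2n]! * (inv! k * rhsSum N (k ℕ.+ 1))) 2n∸N≡1+r ⟨
    [2n]! * (inv! (2 ℕ.* n ∸ N) * rhsSum N (2 ℕ.* n ∸ N ℕ.+ 1))
                                                         ≡⟨ ℚₚ.*-assoc [2n]! (inv! (2 ℕ.* n ∸ N)) (rhsSum N (2 ℕ.* n ∸ N ℕ.+ 1)) ⟨
    [2n]! * inv! (2 ℕ.* n ∸ N) * rhsSum N (2 ℕ.* n ∸ N ℕ.+ 1)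
                                                         ≡⟨ umbral-rhsPoly N n ⟨
    umbral (rhsPoly N n)                                 ∎
    where
    [2n]! = ℕ→ℚ ((2 ℕ.* n) !)
    N+[1+r]≡double : N ℕ.+ suc r ≡ double n
    N+[1+r]≡double = trans (ℕₚ.+-suc N r) (trans N+1+r≡2n (sym (double≡2* n)))
    2n∸N≡1+r : 2 ℕ.* n ∸ N ≡ suc r
    2n∸N≡1+r = trans (cong (_∸ N) (sym (trans (ℕₚ.+-suc N r) N+1+r≡2n))) (ℕₚ.m+n∸m≡n N (suc r))

open ClosedForm using (S≡umbral-rhsPoly)
open import Data.Nat using (ℕ; _≤_; _<_; _*_)
open import Relation.Binary.PropositionalEquality using (_≡_)

proposition5p2 : (N n : ℕ) → 1 ≤ N → N < 2 * n →
    S N n ≡ umbral (rhsPoly N n)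
proposition5p2 N n _ = S≡umbral-rhsPoly N n
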